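{- For $n\geq 2$ and $k\geq 1$, \[ d_{n,k}=2k\,d_{n-1,k}+(2n-2k+1)\,d_{n-1,k-1}+2(n-1)\,d_{n-2,k-1}. \]
   Context: Let $B_n$ be the set of signed permutations $\sigma=\sigma_1\cdots\sigma_n$ of $[n]=\{1,\dots,n\}$ (permutations of $[n]$ in which some entries carry a minus sign). An index $i\in[n]$ is a type $B$ excedance of $\sigma$ if either $\sigma_i=-i$ or $\sigma_{|\sigma_i|}>\sigma_i$; $\mathrm{exc}_B(\sigma)$ denotes the number of type $B$ excedances. A type $B$ derangement is $\sigma\in B_n$ with $\sigma_i\neq i$ for all $i\in[n]$ (entries $\sigma_i=-i$ are allowed); $D_n^B$ is the set of these. Define $d_n^B(q)=\sum_{\sigma\in D_n^B}q^{\mathrm{exc}_B(\sigma)}$ for $n\geq1$ and $d_0^B(q)=1$, and let $d_{n,k}$ denote the coefficient of $q^k$ in $d_n^B(q)$ (so for $n\ge1$, $d_{n,k}$ is the number of $\sigma\in D_n^B$ with $\mathrm{exc}_B(\sigma)=k$; $d_{0,0}=1$; and $d_{n,k}=0$ for $k$ outside the range of exponents). -}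

module Defs where

open import Data.Nat using (ℕ; zero; suc)
import Data.Nat as ℕ
open import Data.Integer using (ℤ; +_; -_; ∣_∣; _<?_)
import Data.Integer as ℤ
open import Data.Fin using (Fin; toℕ)
open import Data.Vec using (Vec; []; _∷_; toList)
import Data.Vec as Vec
open import Data.List using (List; []; _∷_; concatMap; map; filter; length; upTo)
open import Data.Bool.ListAction using (any; all)
import Data.List as List
open import Data.Bool using (Bool; true; false; _∨_; not)
open import Relation.Nullary.Decidable using (⌊_⌋)

-- A signed permutation σ = σ₁ ⋯ σₙ is represented as a vector of integers
-- (one-line notation); position i (1-indexed) is stored at Fin index i-1.

signedVals : ℕ → List ℤ
signedVals n = concatMap (λ j → (+ suc j) ∷ (- (+ suc j)) ∷ []) (upTo n)

vecsOver : (m : ℕ) → List ℤ → List (Vec ℤ m)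
vecsOver zero    xs = [] ∷ []
vecsOver (suc m) xs = concatMap (λ x → map (x ∷_) (vecsOver m xs)) xs

-- 1-indexed entry σ_j (value 0 if j is out of range; never used in range [1..n]).
entry : ∀ {n} → Vec ℤ n → ℕ → ℤ
entry []       _             = + 0
entry (x ∷ σ)  zero          = + 0
entry (x ∷ σ)  (suc zero)    = x
entry (x ∷ σ)  (suc (suc j)) = entry σ (suc j)

-- σ (entries in ±[n], length n) is a signed permutation iff every j ∈ [n]
-- occurs as |σ_i| for some i.
isSignedPerm : ∀ n → Vec ℤ n → Bool
isSignedPerm n σ = all (λ j → any (λ x → ⌊ ∣ x ∣ ℕ.≟ suc j ⌋) (toList σ)) (upTo n)

Bn : (n : ℕ) → List (Vec ℤ n)
Bn n = filter (λ σ → isSignedPerm n σ Data.Bool.≟ true) (vecsOver n (signedVals n))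
  where import Data.Bool

isDerangementB : ∀ {n} → Vec ℤ n → Bool
isDerangementB {n} σ = all (λ i → not ⌊ entry σ (suc i) ℤ.≟ + suc i ⌋) (upTo n)

DnB : (n : ℕ) → List (Vec ℤ n)
DnB n = filter (λ σ → isDerangementB σ Data.Bool.≟ true) (Bn n)
  where import Data.Bool

isExcB : ∀ {n} → Vec ℤ n → ℕ → Bool
isExcB σ i = ⌊ entry σ i ℤ.≟ - (+ i) ⌋ ∨ ⌊ entry σ i <? entry σ ∣ entry σ i ∣ ⌋

excB : ∀ {n} → Vec ℤ n → ℕ
excB {n} σ = length (filter (λ i → isExcB σ (suc i) Data.Bool.≟ true) (upTo n))
  where import Data.Bool

-- For n = 0, D_0^B consists of the
-- empty signed permutation with exc_B = 0, so d_{0,0} = 1 and d_{0,k} = 0 otherwise,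
-- matching the convention d_0^B(q) = 1.
d : ℕ → ℕ → ℕ
d n k = length (filter (λ σ → excB σ ℕ.≟ k) (DnB n))

-- Sort σ ∈ D_n^B by the place of its entry ±n. If it is last it must be −n; deleting it leaves a
-- derangement of [n−1] with one excedance fewer. If it is in place j+1 < n, then σ arises from a
-- unique w ∈ B_{n−1} by putting ±n in place j+1 and moving w_{j+1} to the end. Then σ is a
-- derangement iff w is one, or j+1 is the only fixed point of w; and exc σ = exc w + 1 − [p is an
-- excedance of w] for the p with |w_p| = j+1. For a derangement w with e excedances, summing over
-- j is summing over p, which gives e [e = k] + (n−1−e) [e = k−1] for each sign of ±n. A w whose
-- only fixed point is j+1 has exc w = k−1, and deleting that fixed point and relabelling leaves
-- D_{n−2}^B. Altogether
-- d_{n,k} = d_{n−1,k−1} + 2k d_{n−1,k} + 2(n−k) d_{n−1,k−1} + 2(n−1) d_{n−2,k−1}.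

module Submission where

module TypeBDerangements where

  open import Algebra.Structures using (IsCommutativeMonoid)
  open import Data.Bool using (Bool; true; false; _∧_; _∨_; not; if_then_else_; T; T?)
  import Data.Bool.Properties as 𝔹
  open import Data.Bool.ListAction using (all; any)
  open import Data.Empty using (⊥; ⊥-elim)
  open import Data.Integer using (ℤ; +_; -_; -[1+_]; ∣_∣)
  import Data.Integer as ℤ
  import Data.Integer.Properties as ℤ
  import Data.Integer.Tactic.RingSolver as ℤ-Solver
  open import Data.List using (List; []; _∷_; _++_; map; concatMap; filter; filterᵇ; foldr; length; upTo; applyUpTo)
  open import Data.List.Properties using (upTo-∷ʳ; map-++; ++-identityʳ; concatMap-++; map-id-local; map-cong; map-∘; map-upTo; map-applyUpTo; filter-++; filter-all; filter-none)
  open import Data.List.Relation.Unary.All as All using (All; []; _∷_)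
  open import Data.List.Relation.Unary.All.Properties using (++⁺; map⁺)
  open import Data.Nat using (ℕ; zero; suc; _+_; _*_; _∸_; _≤_; _<_; z≤n; s≤s; _≡ᵇ_; _<ᵇ_)
  import Data.Nat as ℕ
  open import Data.Nat.Properties
  open import Data.Nat.Tactic.RingSolver using (solve-∀)
  open import Data.Product using (Σ; _×_; _,_; proj₁; proj₂)
  open import Data.Sum using (_⊎_; inj₁; inj₂)
  open import Data.Vec using (Vec; []; _∷_; _∷ʳ_; toList)
  import Data.Vec as Vec
  import Data.Vec.Relation.Unary.All as Vecᴬ
  open import Function using (_∘_)
  open import Relation.Binary.Definitions using (tri<; tri≈; tri>)
  open import Relation.Binary.PropositionalEquality
  open import Relation.Nullary using (Dec; yes; no; ¬_)
  open import Relation.Nullary.Decidable using (⌊_⌋; isYes≗does; dec-true; dec-false)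

  open import Defs

  private
    variable
      A B : Set

  ⌊⌋-true : (a? : Dec A) → A → ⌊ a? ⌋ ≡ true
  ⌊⌋-true a? a = trans (isYes≗does a?) (dec-true a? a)

  ⌊⌋-false : (a? : Dec A) → ¬ A → ⌊ a? ⌋ ≡ false
  ⌊⌋-false a? ¬a = trans (isYes≗does a?) (dec-false a? ¬a)

  ⌊⌋-sound : (a? : Dec A) → ⌊ a? ⌋ ≡ true → A
  ⌊⌋-sound (yes a) _ = a

  ⌊⌋-cong-⇔ : (a? : Dec A) (b? : Dec B) → (A → B) → (B → A) → ⌊ a? ⌋ ≡ ⌊ b? ⌋
  ⌊⌋-cong-⇔ (yes a) (yes b) _ _ = refl
  ⌊⌋-cong-⇔ (yes a) (no ¬b) f _ = ⊥-elim (¬b (f a))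
  ⌊⌋-cong-⇔ (no ¬a) (yes b) _ g = ⊥-elim (¬a (g b))
  ⌊⌋-cong-⇔ (no ¬a) (no ¬b) _ _ = refl

  ≡-by-true : ∀ {a b} → (a ≡ true → b ≡ true) → (b ≡ true → a ≡ true) → a ≡ b
  ≡-by-true {true}  {true}  _ _ = refl
  ≡-by-true {true}  {false} f _ = sym (f refl)
  ≡-by-true {false} {true}  _ g = g refl
  ≡-by-true {false} {false} _ _ = refl

  ∧-true : ∀ {a b} → a ≡ true → b ≡ true → a ∧ b ≡ true
  ∧-true refl refl = refl

  ∨-true⇒ : ∀ {a b} → a ∨ b ≡ true → a ≡ true ⊎ b ≡ true
  ∨-true⇒ {true}  _ = inj₁ refl
  ∨-true⇒ {false} e = inj₂ e

  ∨-trueˡ : ∀ {a} b → a ≡ true → a ∨ b ≡ true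
  ∨-trueˡ b refl = refl

  ∨-trueʳ : ∀ a {b} → b ≡ true → a ∨ b ≡ true
  ∨-trueʳ true  _ = refl
  ∨-trueʳ false e = e

  true≢false : ∀ {a} → a ≡ true → a ≡ false → ⊥
  true≢false refl ()

  ∧-zero₃ : ∀ a b c → a ∧ b ∧ false ∧ c ≡ false
  ∧-zero₃ a b c = trans (cong (a ∧_) (𝔹.∧-zeroʳ b)) (𝔹.∧-zeroʳ a)

  χ : Bool → ℕ
  χ true  = 1
  χ false = 0

  χ-∧ : ∀ a b → χ (a ∧ b) ≡ χ a * χ b
  χ-∧ true  b = sym (+-identityʳ (χ b))
  χ-∧ false b = refl

  χ-not+χ : ∀ s → χ (not s) + χ s ≡ 1
  χ-not+χ true  = refl
  χ-not+χ false = refl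

  skip : ℕ → ℕ → ℕ
  skip j i = if i <ᵇ j then i else suc i

  <ᵇ-true : ∀ {a b} → a < b → (a <ᵇ b) ≡ true
  <ᵇ-true {zero}  {suc b} _       = refl
  <ᵇ-true {suc a} {suc b} (s≤s l) = <ᵇ-true l

  <ᵇ-false : ∀ {a b} → b ≤ a → (a <ᵇ b) ≡ false
  <ᵇ-false {a}     {zero}  _       = refl
  <ᵇ-false {suc a} {suc b} (s≤s l) = <ᵇ-false l

  skip-< : ∀ {j i} → i < j → skip j i ≡ i
  skip-< i<j rewrite <ᵇ-true i<j = refl

  skip-≥ : ∀ {j i} → j ≤ i → skip j i ≡ suc i
  skip-≥ j≤i rewrite <ᵇ-false j≤i = refl

  -- `all`, `any` and the sums ∑ below are all instances of `fold`.
  module CommutativeFold {C : Set} {_∙_ : C → C → C} {ε : C} (isCM : IsCommutativeMonoid _≡_ _∙_ ε) where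
    open IsCommutativeMonoid isCM using (assoc; comm; identityˡ; identityʳ)

    fold : List A → (A → C) → C
    fold xs h = foldr _∙_ ε (map h xs)

    fold-++ : ∀ (xs ys : List A) h → fold (xs ++ ys) h ≡ fold xs h ∙ fold ys h
    fold-++ []       ys h = sym (identityˡ _)
    fold-++ (x ∷ xs) ys h = trans (cong (h x ∙_) (fold-++ xs ys h)) (sym (assoc _ _ _))

    fold< : ℕ → (ℕ → C) → C
    fold< n = fold (upTo n)

    fold<-suc : ∀ n h → fold< (suc n) h ≡ fold< n h ∙ h n
    fold<-suc n h = begin
      fold (upTo (suc n)) h       ≡⟨ cong (λ l → fold l h) (sym (upTo-∷ʳ n)) ⟩
      fold (upTo n ++ n ∷ []) h   ≡⟨ fold-++ (upTo n) (n ∷ []) h ⟩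
      fold< n h ∙ (h n ∙ ε)       ≡⟨ cong (fold< n h ∙_) (identityʳ (h n)) ⟩
      fold< n h ∙ h n             ∎
      where open ≡-Reasoning

    fold<-cong : ∀ n {g h} → (∀ j → j < n → g j ≡ h j) → fold< n g ≡ fold< n h
    fold<-cong zero    eq = refl
    fold<-cong (suc n) {g} {h} eq = begin
      fold< (suc n) g     ≡⟨ fold<-suc n g ⟩
      fold< n g ∙ g n     ≡⟨ cong₂ _∙_ (fold<-cong n (λ j j<n → eq j (m<n⇒m<1+n j<n))) (eq n (n<1+n n)) ⟩
      fold< n h ∙ h n     ≡⟨ sym (fold<-suc n h) ⟩
      fold< (suc n) h     ∎
      where open ≡-Reasoning

    fold<-skip : ∀ j t h → j < suc t → fold< (suc t) h ≡ fold< t (h ∘ skip j) ∙ h j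
    fold<-skip j t h j<1+t with j ≟ t
    ... | yes refl = trans (fold<-suc j h) (cong (_∙ h j) (fold<-cong j (λ i i<j → cong h (sym (skip-< i<j)))))
    fold<-skip j (suc t) h j<1+t | no j≢t = begin
      fold< (suc (suc t)) h                                 ≡⟨ fold<-suc (suc t) h ⟩
      fold< (suc t) h ∙ h (suc t)                           ≡⟨ cong (_∙ h (suc t)) (fold<-skip j t h j<1+t′) ⟩
      (fold< t (h ∘ skip j) ∙ h j) ∙ h (suc t)              ≡⟨ assoc _ _ _ ⟩
      fold< t (h ∘ skip j) ∙ (h j ∙ h (suc t))              ≡⟨ cong (fold< t (h ∘ skip j) ∙_) (comm _ _) ⟩
      fold< t (h ∘ skip j) ∙ (h (suc t) ∙ h j)              ≡⟨ sym (assoc _ _ _) ⟩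
      (fold< t (h ∘ skip j) ∙ h (suc t)) ∙ h j              ≡⟨ cong (λ z → (fold< t (h ∘ skip j) ∙ h z) ∙ h j) (sym (skip-≥ j≤t)) ⟩
      (fold< t (h ∘ skip j) ∙ h (skip j t)) ∙ h j           ≡⟨ cong (_∙ h j) (sym (fold<-suc t (h ∘ skip j))) ⟩
      fold< (suc t) (h ∘ skip j) ∙ h j                      ∎
      where
      open ≡-Reasoning
      j<1+t′ : j < suc t
      j<1+t′ = ≤∧≢⇒< (≤-pred j<1+t) j≢t
      j≤t : j ≤ t
      j≤t = ≤-pred j<1+t′
    fold<-skip zero    zero h _         | no j≢t = ⊥-elim (j≢t refl)
    fold<-skip (suc j) zero h (s≤s ()) | no _

  ≡ᵇ-refl : ∀ a → (a ≡ᵇ a) ≡ true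
  ≡ᵇ-refl zero    = refl
  ≡ᵇ-refl (suc a) = ≡ᵇ-refl a

  ≡ᵇ-≢ : ∀ {a b} → a ≢ b → (a ≡ᵇ b) ≡ false
  ≡ᵇ-≢ {zero}  {zero}  ne = ⊥-elim (ne refl)
  ≡ᵇ-≢ {zero}  {suc b} ne = refl
  ≡ᵇ-≢ {suc a} {zero}  ne = refl
  ≡ᵇ-≢ {suc a} {suc b} ne = ≡ᵇ-≢ (ne ∘ cong suc)

  ≡ᵇ-≡ : ∀ {a b} → a ≡ b → (a ≡ᵇ b) ≡ true
  ≡ᵇ-≡ {a} refl = ≡ᵇ-refl a

  ≡ᵇ-sound : ∀ a b → (a ≡ᵇ b) ≡ true → a ≡ b
  ≡ᵇ-sound zero    zero    _ = refl
  ≡ᵇ-sound (suc a) (suc b) e = cong suc (≡ᵇ-sound a b e)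

  open CommutativeFold +-0-isCommutativeMonoid using ()
    renaming (fold to ∑; fold-++ to ∑-++; fold< to ∑<; fold<-suc to ∑<-suc; fold<-cong to ∑<-cong; fold<-skip to ∑<-skip)
  module AllFold = CommutativeFold 𝔹.∧-isCommutativeMonoid
  module AnyFold = CommutativeFold 𝔹.∨-isCommutativeMonoid

  ∑-cong : ∀ (xs : List A) {g h} → (∀ x → g x ≡ h x) → ∑ xs g ≡ ∑ xs h
  ∑-cong []       eq = refl
  ∑-cong (x ∷ xs) eq = cong₂ _+_ (eq x) (∑-cong xs eq)

  ∑-congᴬ : ∀ {xs : List A} {g h} → All (λ x → g x ≡ h x) xs → ∑ xs g ≡ ∑ xs h
  ∑-congᴬ []       = refl
  ∑-congᴬ (e ∷ es) = cong₂ _+_ e (∑-congᴬ es)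

  ∑-zero : ∀ (xs : List A) {g} → (∀ x → g x ≡ 0) → ∑ xs g ≡ 0
  ∑-zero []       eq = refl
  ∑-zero (x ∷ xs) eq = cong₂ _+_ (eq x) (∑-zero xs eq)

  ∑-zeroᴬ : ∀ {xs : List A} {g} → All (λ x → g x ≡ 0) xs → ∑ xs g ≡ 0
  ∑-zeroᴬ []       = refl
  ∑-zeroᴬ (e ∷ es) = cong₂ _+_ e (∑-zeroᴬ es)

  ∑-+ : ∀ (xs : List A) g h → ∑ xs (λ x → g x + h x) ≡ ∑ xs g + ∑ xs h
  ∑-+ []       g h = refl
  ∑-+ (x ∷ xs) g h rewrite ∑-+ xs g h = +-assoc-comm (g x) (h x) (∑ xs g) (∑ xs h)
    where
    +-assoc-comm : ∀ a b c d → a + b + (c + d) ≡ a + c + (b + d)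
    +-assoc-comm = solve-∀

  ∑-*ˡ : ∀ (xs : List A) c g → ∑ xs (λ x → c * g x) ≡ c * ∑ xs g
  ∑-*ˡ []       c g = sym (*-zeroʳ c)
  ∑-*ˡ (x ∷ xs) c g rewrite ∑-*ˡ xs c g = sym (*-distribˡ-+ c (g x) (∑ xs g))

  ∑-*ʳ : ∀ (xs : List A) g c → ∑ xs (λ x → g x * c) ≡ ∑ xs g * c
  ∑-*ʳ xs g c = trans (∑-cong xs (λ x → *-comm (g x) c)) (trans (∑-*ˡ xs c g) (*-comm c (∑ xs g)))

  ∑-map : ∀ (f : B → A) (xs : List B) g → ∑ (map f xs) g ≡ ∑ xs (g ∘ f)
  ∑-map f []       g = refl
  ∑-map f (x ∷ xs) g = cong (_+_ (g (f x))) (∑-map f xs g)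

  ∑-concatMap : ∀ (f : B → List A) (xs : List B) g → ∑ (concatMap f xs) g ≡ ∑ xs (λ x → ∑ (f x) g)
  ∑-concatMap f []       g = refl
  ∑-concatMap f (x ∷ xs) g = trans (∑-++ (f x) (concatMap f xs) g) (cong (_+_ (∑ (f x) g)) (∑-concatMap f xs g))

  ∑-swap : ∀ (xs : List A) (ys : List B) (f : A → B → ℕ) → ∑ xs (λ x → ∑ ys (f x)) ≡ ∑ ys (λ y → ∑ xs (λ x → f x y))
  ∑-swap []       ys f = sym (∑-zero ys (λ _ → refl))
  ∑-swap (x ∷ xs) ys f = trans (cong (_+_ (∑ ys (f x))) (∑-swap xs ys f)) (sym (∑-+ ys (f x) (λ y → ∑ xs (λ x′ → f x′ y))))

  ∑-filter : ∀ {P : A → Set} (P? : ∀ x → Dec (P x)) (xs : List A) g → ∑ (filter P? xs) g ≡ ∑ xs (λ x → χ ⌊ P? x ⌋ * g x)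
  ∑-filter P? []       g = refl
  ∑-filter P? (x ∷ xs) g with P? x
  ... | yes _ = cong₂ _+_ (sym (+-identityʳ (g x))) (∑-filter P? xs g)
  ... | no  _ = ∑-filter P? xs g

  length≡∑1 : ∀ (xs : List A) → length xs ≡ ∑ xs (λ _ → 1)
  length≡∑1 []       = refl
  length≡∑1 (x ∷ xs) = cong suc (length≡∑1 xs)

  ∑<-sucˡ : ∀ n g → ∑< (suc n) g ≡ g 0 + ∑< n (g ∘ suc)
  ∑<-sucˡ n g = cong (λ l → g 0 + foldr _+_ 0 l) (trans (map-applyUpTo suc g n) (sym (map-upTo (g ∘ suc) n)))

  ∑<-zero : ∀ n {g} → (∀ j → j < n → g j ≡ 0) → ∑< n g ≡ 0
  ∑<-zero n eq = trans (∑<-cong n eq) (∑-zero (upTo n) (λ _ → refl))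

  ∑<-const : ∀ n c → ∑< n (λ _ → c) ≡ n * c
  ∑<-const zero    c = refl
  ∑<-const (suc n) c = trans (∑<-suc n _) (trans (cong (_+ c) (∑<-const n c)) (+-comm (n * c) c))

  ∑<-mono-≤ : ∀ n {g h} → (∀ j → j < n → g j ≤ h j) → ∑< n g ≤ ∑< n h
  ∑<-mono-≤ zero    le = z≤n
  ∑<-mono-≤ (suc n) {g} {h} le rewrite ∑<-suc n g | ∑<-suc n h =
    +-mono-≤ (∑<-mono-≤ n (λ j j<n → le j (m<n⇒m<1+n j<n))) (le n (n<1+n n))

  +-right-comm : ∀ a b c → a + b + c ≡ a + c + b
  +-right-comm = solve-∀

  erase : ℕ → (ℕ → ℕ) → ℕ → ℕ
  erase a g j = if j ≡ᵇ a then 0 else g j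

  erase-cong : ∀ a {g h} i → (i ≢ a → g i ≡ h i) → erase a g i ≡ erase a h i
  erase-cong a i eq with i ≟ a
  ... | yes i≡a rewrite ≡ᵇ-≡ i≡a = refl
  ... | no  i≢a rewrite ≡ᵇ-≢ i≢a = eq i≢a

  ∑<-erase : ∀ n a g → a < n → ∑< n g ≡ ∑< n (erase a g) + g a
  ∑<-erase zero    a g ()
  ∑<-erase (suc n) a g a<1+n with a ≟ n
  ... | yes refl = begin
      ∑< (suc a) g                    ≡⟨ ∑<-suc a g ⟩
      ∑< a g + g a                    ≡⟨ cong (_+ g a) (∑<-cong a (λ j j<a → sym (erase-≢ j (<⇒≢ j<a)))) ⟩
      ∑< a (erase a g) + g a          ≡⟨ cong (_+ g a) (sym erase-last) ⟩
      ∑< (suc a) (erase a g) + g a    ∎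
    where
    open ≡-Reasoning
    erase-≢ : ∀ j → j ≢ a → erase a g j ≡ g j
    erase-≢ j j≢a rewrite ≡ᵇ-≢ j≢a = refl
    erase-last : ∑< (suc a) (erase a g) ≡ ∑< a (erase a g)
    erase-last rewrite ∑<-suc a (erase a g) | ≡ᵇ-refl a = +-identityʳ _
  ... | no a≢n = begin
      ∑< (suc n) g                         ≡⟨ ∑<-suc n g ⟩
      ∑< n g + g n                         ≡⟨ cong (_+ g n) (∑<-erase n a g (≤∧≢⇒< (≤-pred a<1+n) a≢n)) ⟩
      ∑< n (erase a g) + g a + g n         ≡⟨ +-right-comm (∑< n (erase a g)) (g a) (g n) ⟩
      ∑< n (erase a g) + g n + g a         ≡⟨ cong (λ z → ∑< n (erase a g) + z + g a) (sym erase-n) ⟩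
      ∑< n (erase a g) + erase a g n + g a ≡⟨ cong (_+ g a) (sym (∑<-suc n (erase a g))) ⟩
      ∑< (suc n) (erase a g) + g a         ∎
    where
    open ≡-Reasoning
    erase-n : erase a g n ≡ g n
    erase-n rewrite ≡ᵇ-≢ (a≢n ∘ sym) = refl

  ∑<-erase₂ : ∀ n g p j → p < n → j < n → p ≢ j → ∑< n g ≡ ∑< n (erase p (erase j g)) + g p + g j
  ∑<-erase₂ n g p j p<n j<n p≢j = trans (∑<-erase n j g j<n) (cong (_+ g j) (trans (∑<-erase n p (erase j g) p<n)
    (cong (_+_ (∑< n (erase p (erase j g)))) (cong (λ b → if b then 0 else g p) (≡ᵇ-≢ p≢j)))))

  ∑<-indicator : ∀ n x (H : ℕ → ℕ) → x < n → ∑< n (λ v → χ (x ≡ᵇ v) * H v) ≡ H x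
  ∑<-indicator zero    x H ()
  ∑<-indicator (suc n) x H x<1+n with x ≟ n
  ... | yes refl = trans (∑<-suc x (λ v → χ (x ≡ᵇ v) * H v)) (trans (cong₂ _+_ rest (cong (λ b → χ b * H x) (≡ᵇ-refl x))) (+-identityʳ (H x)))
    where
    rest : ∑< x (λ v → χ (x ≡ᵇ v) * H v) ≡ 0
    rest = ∑<-zero x (λ j j<x → cong (λ b → χ b * H j) (≡ᵇ-≢ (<⇒≢ j<x ∘ sym)))
  ... | no x≢n = trans (∑<-suc n (λ v → χ (x ≡ᵇ v) * H v))
    (trans (cong₂ _+_ (∑<-indicator n x H (≤∧≢⇒< (≤-pred x<1+n) x≢n)) (cong (λ b → χ b * H n) (≡ᵇ-≢ x≢n))) (+-identityʳ (H x)))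

  ∑<-positive : ∀ n {g} → (∀ j → j < n → 1 ≤ g j) → n ≤ ∑< n g
  ∑<-positive n {g} pos = subst (_≤ ∑< n g) (trans (∑<-const n 1) (*-identityʳ n)) (∑<-mono-≤ n pos)

  ∑<-positive-tight : ∀ n {g} → (∀ j → j < n → 1 ≤ g j) → ∑< n g ≤ n → ∀ j → j < n → g j ≡ 1
  ∑<-positive-tight (suc n) {g} pos ∑≤ j j<1+n with j ≟ n
  ... | yes refl = ≤-antisym (+-cancelˡ-≤ n (g n) 1 (≤-trans (+-monoˡ-≤ (g n) below) total≤)) (pos n j<1+n)
    where
    below : n ≤ ∑< n g
    below = ∑<-positive n (λ i i<n → pos i (m<n⇒m<1+n i<n))
    total≤ : ∑< n g + g n ≤ n + 1
    total≤ = subst₂ _≤_ (∑<-suc n g) (+-comm 1 n) ∑≤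
  ... | no j≢n = ∑<-positive-tight n (λ i i<n → pos i (m<n⇒m<1+n i<n)) ∑<n≤n j (≤∧≢⇒< (≤-pred j<1+n) j≢n)
    where
    ∑<n≤n : ∑< n g ≤ n
    ∑<n≤n = +-cancelʳ-≤ 1 (∑< n g) n (≤-trans (+-monoʳ-≤ (∑< n g) (pos n (n<1+n n))) (subst₂ _≤_ (∑<-suc n g) (+-comm 1 n) ∑≤))

  setAt : ∀ {m} → Vec A m → ℕ → A → Vec A m
  setAt []      j       y = []
  setAt (x ∷ v) zero    y = y ∷ v
  setAt (x ∷ v) (suc j) y = x ∷ setAt v j y

  insertAt : ∀ {m} → Vec A m → ℕ → A → Vec A (suc m)
  insertAt v        zero    x = x ∷ v
  insertAt []       (suc j) x = x ∷ []
  insertAt (x′ ∷ v) (suc j) x = x′ ∷ insertAt v j x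

  countᵇ : ∀ {m} → (A → Bool) → Vec A m → ℕ
  countᵇ p []      = 0
  countᵇ p (x ∷ v) = χ (p x) + countᵇ p v

  countᵇ-insertAt : ∀ {m} (p : A → Bool) (u : Vec A m) j x → countᵇ p (insertAt u j x) ≡ χ (p x) + countᵇ p u
  countᵇ-insertAt p u        zero    x = refl
  countᵇ-insertAt p []       (suc j) x = refl
  countᵇ-insertAt p (x′ ∷ u) (suc j) x = trans (cong (_+_ (χ (p x′))) (countᵇ-insertAt p u j x)) (+-left-comm (χ (p x′)) (χ (p x)) (countᵇ p u))
    where
    +-left-comm : ∀ a b c → a + (b + c) ≡ b + (a + c)
    +-left-comm = solve-∀

  ∑-vecsOver-[] : ∀ xs (F : Vec ℤ 0 → ℕ) → ∑ (vecsOver 0 xs) F ≡ F []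
  ∑-vecsOver-[] xs F = +-identityʳ (F [])

  ∑-vecsOver-∷ : ∀ m xs (F : Vec ℤ (suc m) → ℕ) → ∑ (vecsOver (suc m) xs) F ≡ ∑ xs (λ x → ∑ (vecsOver m xs) (λ w → F (x ∷ w)))
  ∑-vecsOver-∷ m xs F = trans (∑-concatMap (λ x → map (x ∷_) (vecsOver m xs)) xs F) (∑-cong xs (λ x → ∑-map (x ∷_) (vecsOver m xs) F))

  ∑-vecsOver-∷ʳ : ∀ m xs (F : Vec ℤ (suc m) → ℕ) → ∑ (vecsOver (suc m) xs) F ≡ ∑ (vecsOver m xs) (λ w → ∑ xs (λ x → F (w ∷ʳ x)))
  ∑-vecsOver-∷ʳ zero    xs F = trans (∑-vecsOver-∷ 0 xs F) (trans (∑-cong xs (λ x → ∑-vecsOver-[] xs (λ w → F (x ∷ w))))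
    (sym (∑-vecsOver-[] xs (λ w → ∑ xs (λ x → F (w ∷ʳ x))))))
  ∑-vecsOver-∷ʳ (suc m) xs F = trans (∑-vecsOver-∷ (suc m) xs F) (trans (∑-cong xs (λ x → ∑-vecsOver-∷ʳ m xs (λ w → F (x ∷ w))))
    (sym (∑-vecsOver-∷ m xs (λ w → ∑ xs (λ x → F (w ∷ʳ x))))))

  ∑-vecsOver-insertAt : ∀ m j xs (F : Vec ℤ (suc m) → ℕ) → j ≤ m →
    ∑ (vecsOver (suc m) xs) F ≡ ∑ xs (λ x → ∑ (vecsOver m xs) (λ u → F (insertAt u j x)))
  ∑-vecsOver-insertAt m       zero    xs F _         = ∑-vecsOver-∷ m xs F
  ∑-vecsOver-insertAt (suc m) (suc j) xs F (s≤s j≤m) = begin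
    ∑ (vecsOver (suc (suc m)) xs) F
      ≡⟨ ∑-vecsOver-∷ (suc m) xs F ⟩
    ∑ xs (λ x′ → ∑ (vecsOver (suc m) xs) (λ w → F (x′ ∷ w)))
      ≡⟨ ∑-cong xs (λ x′ → ∑-vecsOver-insertAt m j xs (λ w → F (x′ ∷ w)) j≤m) ⟩
    ∑ xs (λ x′ → ∑ xs (λ x → ∑ (vecsOver m xs) (λ u → F (x′ ∷ insertAt u j x))))
      ≡⟨ ∑-swap xs xs (λ x′ x → ∑ (vecsOver m xs) (λ u → F (x′ ∷ insertAt u j x))) ⟩
    ∑ xs (λ x → ∑ xs (λ x′ → ∑ (vecsOver m xs) (λ u → F (x′ ∷ insertAt u j x))))
      ≡⟨ ∑-cong xs (λ x → sym (∑-vecsOver-∷ m xs (λ u → F (insertAt u (suc j) x)))) ⟩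
    ∑ xs (λ x → ∑ (vecsOver (suc m) xs) (λ u → F (insertAt u (suc j) x)))
      ∎
    where open ≡-Reasoning

  ∑-vecsOver-map : ∀ m xs (φ : ℤ → ℤ) (F : Vec ℤ m → ℕ) → ∑ (vecsOver m (map φ xs)) F ≡ ∑ (vecsOver m xs) (F ∘ Vec.map φ)
  ∑-vecsOver-map zero    xs φ F = trans (∑-vecsOver-[] (map φ xs) F) (sym (∑-vecsOver-[] xs (F ∘ Vec.map φ)))
  ∑-vecsOver-map (suc m) xs φ F = begin
    ∑ (vecsOver (suc m) (map φ xs)) F
      ≡⟨ ∑-vecsOver-∷ m (map φ xs) F ⟩
    ∑ (map φ xs) (λ x → ∑ (vecsOver m (map φ xs)) (λ w → F (x ∷ w)))
      ≡⟨ ∑-map φ xs (λ x → ∑ (vecsOver m (map φ xs)) (λ w → F (x ∷ w))) ⟩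
    ∑ xs (λ x → ∑ (vecsOver m (map φ xs)) (λ w → F (φ x ∷ w)))
      ≡⟨ ∑-cong xs (λ x → ∑-vecsOver-map m xs φ (λ w → F (φ x ∷ w))) ⟩
    ∑ xs (λ x → ∑ (vecsOver m xs) (λ w → F (φ x ∷ Vec.map φ w)))
      ≡⟨ sym (∑-vecsOver-∷ m xs (F ∘ Vec.map φ)) ⟩
    ∑ (vecsOver (suc m) xs) (F ∘ Vec.map φ)
      ∎
    where open ≡-Reasoning

  vecsOver-All : ∀ {P : ℤ → Set} m xs → All P xs → All (Vecᴬ.All P) (vecsOver m xs)
  vecsOver-All zero    xs ps = Vecᴬ.[] ∷ []
  vecsOver-All {P} (suc m) xs ps = go xs ps
    where
    go : ∀ ys → All P ys → All (Vecᴬ.All P) (concatMap (λ x → map (x ∷_) (vecsOver m xs)) ys)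
    go []       []         = []
    go (y ∷ ys) (py ∷ pys) = ++⁺ (map⁺ (All.map (py Vecᴬ.∷_) (vecsOver-All m xs ps))) (go ys pys)

  ∑-filterᵇ : ∀ (p : A → Bool) xs g → (∀ x → p x ≡ false → g x ≡ 0) → ∑ xs g ≡ ∑ (filterᵇ p xs) g
  ∑-filterᵇ p []       g h = refl
  ∑-filterᵇ p (x ∷ xs) g h with p x in eq
  ... | true  = cong (_+_ (g x)) (∑-filterᵇ p xs g h)
  ... | false = trans (cong (_+ ∑ xs g) (h x eq)) (∑-filterᵇ p xs g h)

  filterᵇ-not-++ : ∀ (p : A → Bool) {xs ys} → All (λ x → p x ≡ false) xs → All (λ y → p y ≡ true) ys → filterᵇ (not ∘ p) (xs ++ ys) ≡ xs
  filterᵇ-not-++ p {xs} {ys} pxs pys = begin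
    filterᵇ (not ∘ p) (xs ++ ys)                   ≡⟨ filter-++ (T? ∘ not ∘ p) xs ys ⟩
    filterᵇ (not ∘ p) xs ++ filterᵇ (not ∘ p) ys   ≡⟨ cong₂ _++_ (filter-all (T? ∘ not ∘ p) (All.map (λ e → subst (T ∘ not) (sym e) _) pxs))
                                                                  (filter-none (T? ∘ not ∘ p) (All.map (λ e → subst (λ b → ¬ T (not b)) (sym e) (λ ())) pys)) ⟩
    xs ++ []                                       ≡⟨ ++-identityʳ xs ⟩
    xs                                             ∎
    where open ≡-Reasoning

  ∑-vecsOver-filterᵇ : ∀ (p : ℤ → Bool) m xs (H : Vec ℤ m → ℕ) → (∀ v → 1 ≤ countᵇ p v → H v ≡ 0) →
    ∑ (vecsOver m xs) H ≡ ∑ (vecsOver m (filterᵇ (not ∘ p) xs)) H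
  ∑-vecsOver-filterᵇ p zero    xs H h = trans (∑-vecsOver-[] xs H) (sym (∑-vecsOver-[] (filterᵇ (not ∘ p) xs) H))
  ∑-vecsOver-filterᵇ p (suc m) xs H h = begin
    ∑ (vecsOver (suc m) xs) H
      ≡⟨ ∑-vecsOver-∷ m xs H ⟩
    ∑ xs (λ x → ∑ (vecsOver m xs) (λ w → H (x ∷ w)))
      ≡⟨ ∑-cong xs (λ x → ∑-vecsOver-filterᵇ p m xs (λ w → H (x ∷ w)) (λ v c → h (x ∷ v) (≤-trans c (m≤n+m _ _)))) ⟩
    ∑ xs (λ x → ∑ (vecsOver m ys) (λ w → H (x ∷ w)))
      ≡⟨ ∑-filterᵇ (not ∘ p) xs _ vanish ⟩
    ∑ ys (λ x → ∑ (vecsOver m ys) (λ w → H (x ∷ w)))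
      ≡⟨ sym (∑-vecsOver-∷ m ys H) ⟩
    ∑ (vecsOver (suc m) ys) H
      ∎
    where
    open ≡-Reasoning
    ys = filterᵇ (not ∘ p) xs
    vanish : ∀ x → not (p x) ≡ false → ∑ (vecsOver m ys) (λ w → H (x ∷ w)) ≡ 0
    vanish x e = ∑-zero (vecsOver m ys) (λ w → h (x ∷ w) (subst (λ b → 1 ≤ χ b + countᵇ p w) (sym (𝔹.not-injective e)) (s≤s z≤n)))

  -- Each vector with exactly one entry from ys, not in the last place, is `displace w j y` for unique
  -- w (entries in xs), j and y ∈ ys.
  displace : ∀ {m} → Vec ℤ m → ℕ → ℤ → Vec ℤ (suc m)
  displace w j y = setAt w j y ∷ʳ entry w (suc j)

  ∑-vecsOver-split : ∀ (p : ℤ → Bool) m xs ys → All (λ x → p x ≡ false) xs → All (λ y → p y ≡ true) ys →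
    (F : Vec ℤ (suc m) → ℕ) → (∀ v → 2 ≤ countᵇ p v → F v ≡ 0) →
    ∑ (vecsOver (suc m) (xs ++ ys)) F ≡
      ∑ (vecsOver (suc m) xs) F + ∑ ys (λ y → ∑ (vecsOver m xs) (λ w → F (w ∷ʳ y)))
      + ∑< m (λ j → ∑ ys (λ y → ∑ (vecsOver m xs) (λ w → F (displace w j y))))
  ∑-vecsOver-split p zero xs ys pxs pys F van = begin
    ∑ (vecsOver 1 (xs ++ ys)) F
      ≡⟨ trans (∑-vecsOver-∷ 0 (xs ++ ys) F) (∑-cong (xs ++ ys) (λ x → ∑-vecsOver-[] (xs ++ ys) (λ w → F (x ∷ w)))) ⟩
    ∑ (xs ++ ys) (λ x → F (x ∷ []))
      ≡⟨ ∑-++ xs ys _ ⟩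
    ∑ xs (λ x → F (x ∷ [])) + ∑ ys (λ x → F (x ∷ []))
      ≡⟨ cong₂ _+_ (sym (trans (∑-vecsOver-∷ 0 xs F) (∑-cong xs (λ x → ∑-vecsOver-[] xs (λ w → F (x ∷ w))))))
                   (sym (∑-cong ys (λ y → ∑-vecsOver-[] xs (λ w → F (w ∷ʳ y))))) ⟩
    ∑ (vecsOver 1 xs) F + ∑ ys (λ y → ∑ (vecsOver 0 xs) (λ w → F (w ∷ʳ y)))
      ≡⟨ sym (+-identityʳ _) ⟩
    ∑ (vecsOver 1 xs) F + ∑ ys (λ y → ∑ (vecsOver 0 xs) (λ w → F (w ∷ʳ y))) + 0
      ∎
    where open ≡-Reasoning
  ∑-vecsOver-split p (suc m) xs ys pxs pys F van = begin
    ∑ (vecsOver (suc (suc m)) (xs ++ ys)) F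
      ≡⟨ ∑-vecsOver-∷ (suc m) (xs ++ ys) F ⟩
    ∑ (xs ++ ys) G
      ≡⟨ ∑-++ xs ys G ⟩
    ∑ xs G + ∑ ys G
      ≡⟨ cong₂ _+_ (∑-cong xs (λ x → ∑-vecsOver-split p m xs ys pxs pys (λ w → F (x ∷ w)) (λ v c → van (x ∷ v) (≤-trans c (m≤n+m _ _)))))
                   (∑-congᴬ (All.map head-large pys)) ⟩
    ∑ xs (λ x → Af x + Bf x + Cf x) + ∑ ys Y
      ≡⟨ cong (_+ ∑ ys Y) (trans (∑-+ xs (λ x → Af x + Bf x) Cf) (cong (_+ ∑ xs Cf) (∑-+ xs Af Bf))) ⟩
    ∑ xs Af + ∑ xs Bf + ∑ xs Cf + ∑ ys Y
      ≡⟨ trans (+-assoc (∑ xs Af + ∑ xs Bf) (∑ xs Cf) (∑ ys Y)) (cong (_+_ (∑ xs Af + ∑ xs Bf)) (+-comm (∑ xs Cf) (∑ ys Y))) ⟩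
    ∑ xs Af + ∑ xs Bf + (∑ ys Y + ∑ xs Cf)
      ≡⟨ cong₂ _+_ (cong₂ _+_ (sym (∑-vecsOver-∷ (suc m) xs F)) last-small) (cong₂ _+_ first-large later-large) ⟩
    ∑ (vecsOver (suc (suc m)) xs) F + ∑ ys (λ y → ∑ (vecsOver (suc m) xs) (λ w → F (w ∷ʳ y))) + (Gj 0 + ∑< m (Gj ∘ suc))
      ≡⟨ cong (_+_ (∑ (vecsOver (suc (suc m)) xs) F + ∑ ys (λ y → ∑ (vecsOver (suc m) xs) (λ w → F (w ∷ʳ y))))) (sym (∑<-sucˡ m Gj)) ⟩
    ∑ (vecsOver (suc (suc m)) xs) F + ∑ ys (λ y → ∑ (vecsOver (suc m) xs) (λ w → F (w ∷ʳ y))) + ∑< (suc m) Gj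
      ∎
    where
    open ≡-Reasoning
    G  = λ x → ∑ (vecsOver (suc m) (xs ++ ys)) (λ w → F (x ∷ w))
    Af = λ x → ∑ (vecsOver (suc m) xs) (λ w → F (x ∷ w))
    Bf = λ x → ∑ ys (λ y → ∑ (vecsOver m xs) (λ w → F (x ∷ (w ∷ʳ y))))
    Cf = λ x → ∑< m (λ j → ∑ ys (λ y → ∑ (vecsOver m xs) (λ w → F (x ∷ displace w j y))))
    Y  = λ y → ∑ (vecsOver (suc m) xs) (λ w → F (y ∷ w))
    Gj = λ j → ∑ ys (λ y → ∑ (vecsOver (suc m) xs) (λ w → F (displace w j y)))
    head-large : ∀ {y} → p y ≡ true → G y ≡ Y y
    head-large {y} e = trans (∑-vecsOver-filterᵇ p (suc m) (xs ++ ys) (λ w → F (y ∷ w)) van′)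
                             (cong (λ l → ∑ (vecsOver (suc m) l) (λ w → F (y ∷ w))) (filterᵇ-not-++ p pxs pys))
      where
      van′ : ∀ v → 1 ≤ countᵇ p v → F (y ∷ v) ≡ 0
      van′ v c = van (y ∷ v) (subst (λ b → 2 ≤ χ b + countᵇ p v) (sym e) (s≤s c))
    last-small : ∑ xs Bf ≡ ∑ ys (λ y → ∑ (vecsOver (suc m) xs) (λ w → F (w ∷ʳ y)))
    last-small = trans (∑-swap xs ys (λ x y → ∑ (vecsOver m xs) (λ w → F (x ∷ (w ∷ʳ y)))))
                       (∑-cong ys (λ y → sym (∑-vecsOver-∷ m xs (λ w → F (w ∷ʳ y)))))
    first-large : ∑ ys Y ≡ Gj 0
    first-large = ∑-cong ys (λ y → trans (∑-vecsOver-∷ʳ m xs (λ w → F (y ∷ w)))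
      (trans (∑-swap (vecsOver m xs) xs (λ w x → F (y ∷ (w ∷ʳ x)))) (sym (∑-vecsOver-∷ m xs (λ w → F (displace w 0 y))))))
    later-large : ∑ xs Cf ≡ ∑< m (Gj ∘ suc)
    later-large = trans (∑-swap xs (upTo m) (λ x j → ∑ ys (λ y → ∑ (vecsOver m xs) (λ w → F (x ∷ displace w j y)))))
      (∑-cong (upTo m) (λ j → trans (∑-swap xs ys (λ x y → ∑ (vecsOver m xs) (λ w → F (x ∷ displace w j y))))
        (∑-cong ys (λ y → sym (∑-vecsOver-∷ m xs (λ w → F (displace w (suc j) y)))))))

  signedVals-suc : ∀ m → signedVals (suc m) ≡ signedVals m ++ (+ suc m) ∷ - (+ suc m) ∷ []
  signedVals-suc m = trans (cong (concatMap g) (sym (upTo-∷ʳ m)))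
    (trans (concatMap-++ g (upTo m) (m ∷ [])) (cong (signedVals m ++_) (++-identityʳ _)))
    where g = λ j → (+ suc j) ∷ (- (+ suc j)) ∷ []

  InRange : ℕ → ℤ → Set
  InRange m x = 1 ≤ ∣ x ∣ × ∣ x ∣ ≤ m

  signedVals-InRange : ∀ m → All (InRange m) (signedVals m)
  signedVals-InRange zero    = []
  signedVals-InRange (suc m) = subst (All (InRange (suc m))) (sym (signedVals-suc m))
    (++⁺ (All.map (λ (a , b) → a , m≤n⇒m≤1+n b) (signedVals-InRange m)) ((s≤s z≤n , ≤-refl) ∷ (s≤s z≤n , ≤-refl) ∷ []))

  ∑-signedVals-suc : ∀ m H → ∑ (signedVals (suc m)) H ≡ ∑ (signedVals m) H + (H (+ suc m) + H (- (+ suc m)))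
  ∑-signedVals-suc m H = trans (cong (λ l → ∑ l H) (signedVals-suc m))
    (trans (∑-++ (signedVals m) _ H) (cong (λ z → ∑ (signedVals m) H + (H (+ suc m) + z)) (+-identityʳ _)))

  ∑-signedVals-single : ∀ m i (H : ℤ → ℕ) → 1 ≤ i → i ≤ m → (∀ x → x ≢ + i → H x ≡ 0) → ∑ (signedVals m) H ≡ H (+ i)
  ∑-signedVals-single zero    .zero H () z≤n van
  ∑-signedVals-single (suc m) i H 1≤i i≤1+m van with i ≟ suc m
  ... | yes refl = trans (∑-signedVals-suc m H) (trans (cong₂ (λ a b → a + (H (+ i) + b)) below (van _ (λ ()))) (+-identityʳ _))
    where
    below : ∑ (signedVals m) H ≡ 0
    below = ∑-zeroᴬ (All.map (λ {x} (_ , b) → van x (λ e → <-irrefl (cong ∣_∣ e) (s≤s b))) (signedVals-InRange m))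
  ... | no i≢1+m = trans (∑-signedVals-suc m H) (trans (cong₂ _+_
    (∑-signedVals-single m i H 1≤i (≤-pred (≤∧≢⇒< i≤1+m i≢1+m)) van) (cong₂ _+_ (van _ (λ e → i≢1+m (sym (cong ∣_∣ e)))) (van _ (λ ()))))
    (+-identityʳ _))

  -- The predicates of Defs, read on i ↦ σ_i (that is, `entry σ`) so that modified permutations
  -- can be described pointwise.
  isSignedPermᶠ : ℕ → (ℕ → ℤ) → Bool
  isSignedPermᶠ n f = all (λ j → any (λ i → ⌊ ∣ f (suc i) ∣ ℕ.≟ suc j ⌋) (upTo n)) (upTo n)

  isDerangementᶠ : ℕ → (ℕ → ℤ) → Bool
  isDerangementᶠ n f = all (λ i → not ⌊ f (suc i) ℤ.≟ + suc i ⌋) (upTo n)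

  isExcᶠ : (ℕ → ℤ) → ℕ → Bool
  isExcᶠ f i = ⌊ f i ℤ.≟ - (+ i) ⌋ ∨ ⌊ f i ℤ.<? f ∣ f i ∣ ⌋

  excᶠ : ℕ → (ℕ → ℤ) → ℕ
  excᶠ n f = ∑< n (λ i → χ (isExcᶠ f (suc i)))

  inD : ℕ → ℕ → (ℕ → ℤ) → Bool
  inD n k f = isSignedPermᶠ n f ∧ isDerangementᶠ n f ∧ (excᶠ n f ≡ᵇ k)

  all-cong : ∀ {p q : A → Bool} (xs : List A) → (∀ x → p x ≡ q x) → all p xs ≡ all q xs
  all-cong xs e = cong (foldr _∧_ true) (map-cong e xs)

  any-cong : ∀ {p q : A → Bool} (xs : List A) → (∀ x → p x ≡ q x) → any p xs ≡ any q xs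
  any-cong xs e = cong (foldr _∨_ false) (map-cong e xs)

  d≡∑vecsOver : ∀ n k → d n k ≡ ∑ (vecsOver n (signedVals n)) (λ σ → χ (inD n k (entry σ)))
  d≡∑vecsOver n k = begin
    length L₃                                                  ≡⟨ length≡∑1 L₃ ⟩
    ∑ L₃ (λ _ → 1)                                             ≡⟨ ∑-filter (λ σ → excB σ ℕ.≟ k) L₂ _ ⟩
    ∑ L₂ (λ σ → χ ⌊ excB σ ℕ.≟ k ⌋ * 1)                        ≡⟨ ∑-filter (λ σ → isDerangementB σ 𝔹.≟ true) L₁ _ ⟩
    ∑ L₁ (λ σ → χ ⌊ isDerangementB σ 𝔹.≟ true ⌋ * (χ ⌊ excB σ ℕ.≟ k ⌋ * 1))
                                                               ≡⟨ ∑-filter (λ σ → isSignedPerm n σ 𝔹.≟ true) L₀ _ ⟩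
    ∑ L₀ (λ σ → χ ⌊ isSignedPerm n σ 𝔹.≟ true ⌋ * (χ ⌊ isDerangementB σ 𝔹.≟ true ⌋ * (χ ⌊ excB σ ℕ.≟ k ⌋ * 1)))
                                                               ≡⟨ ∑-cong L₀ pointwise ⟩
    ∑ L₀ (λ σ → χ (inD n k (entry σ)))                         ∎
    where
    open ≡-Reasoning
    L₀ = vecsOver n (signedVals n)
    L₁ = filter (λ σ → isSignedPerm n σ 𝔹.≟ true) L₀
    L₂ = filter (λ σ → isDerangementB σ 𝔹.≟ true) L₁
    L₃ = filter (λ σ → excB σ ℕ.≟ k) L₂
    ⌊≟true⌋ : ∀ b → ⌊ b 𝔹.≟ true ⌋ ≡ b
    ⌊≟true⌋ true  = refl
    ⌊≟true⌋ false = refl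
    ⌊≟⌋≡≡ᵇ : ∀ a b → ⌊ a ℕ.≟ b ⌋ ≡ (a ≡ᵇ b)
    ⌊≟⌋≡≡ᵇ a b with a ℕ.≟ b
    ... | yes e = sym (≡ᵇ-≡ e)
    ... | no ne = sym (≡ᵇ-≢ ne)
    toList-entry : ∀ {n} (σ : Vec ℤ n) → toList σ ≡ map (λ i → entry σ (suc i)) (upTo n)
    toList-entry {n} σ = trans (go σ) (sym (map-upTo (λ i → entry σ (suc i)) n))
      where
      go : ∀ {n} (σ : Vec ℤ n) → toList σ ≡ applyUpTo (λ i → entry σ (suc i)) n
      go []      = refl
      go (x ∷ σ) = cong (x ∷_) (go σ)
    isSignedPerm≡ : ∀ (σ : Vec ℤ n) → isSignedPerm n σ ≡ isSignedPermᶠ n (entry σ)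
    isSignedPerm≡ σ = all-cong (upTo n) (λ j → trans (cong (any (λ x → ⌊ ∣ x ∣ ℕ.≟ suc j ⌋)) (toList-entry σ))
      (cong (foldr _∨_ false) (sym (map-∘ (upTo n)))))
    excB≡ : ∀ (σ : Vec ℤ n) → excB σ ≡ excᶠ n (entry σ)
    excB≡ σ = trans (length≡∑1 (filter (λ i → isExcB σ (suc i) 𝔹.≟ true) (upTo n)))
      (trans (∑-filter (λ i → isExcB σ (suc i) 𝔹.≟ true) (upTo n) (λ _ → 1))
        (∑-cong (upTo n) (λ i → trans (*-identityʳ _) (cong χ (⌊≟true⌋ _)))))
    pointwise : ∀ σ → χ ⌊ isSignedPerm n σ 𝔹.≟ true ⌋ * (χ ⌊ isDerangementB σ 𝔹.≟ true ⌋ * (χ ⌊ excB σ ℕ.≟ k ⌋ * 1)) ≡ χ (inD n k (entry σ))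
    pointwise σ rewrite ⌊≟true⌋ (isSignedPerm n σ) | ⌊≟true⌋ (isDerangementB σ) | ⌊≟⌋≡≡ᵇ (excB σ) k | isSignedPerm≡ σ | excB≡ σ
      | χ-∧ (isSignedPermᶠ n (entry σ)) (isDerangementᶠ n (entry σ) ∧ (excᶠ n (entry σ) ≡ᵇ k))
      | χ-∧ (isDerangementᶠ n (entry σ)) (excᶠ n (entry σ) ≡ᵇ k) | *-identityʳ (χ (excᶠ n (entry σ) ≡ᵇ k)) = refl

  module _ (p : ℕ → Bool) where
    private
      all-applyUpTo⁻ : ∀ (f : ℕ → ℕ) n → all p (applyUpTo f n) ≡ true → ∀ j → j < n → p (f j) ≡ true
      all-applyUpTo⁻ f (suc n) e zero    _         = 𝔹.∧-conicalˡ _ _ e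
      all-applyUpTo⁻ f (suc n) e (suc j) (s≤s j<n) = all-applyUpTo⁻ (f ∘ suc) n (𝔹.∧-conicalʳ _ _ e) j j<n

      all-applyUpTo⁺ : ∀ (f : ℕ → ℕ) n → (∀ j → j < n → p (f j) ≡ true) → all p (applyUpTo f n) ≡ true
      all-applyUpTo⁺ f zero    h = refl
      all-applyUpTo⁺ f (suc n) h = ∧-true (h 0 (s≤s z≤n)) (all-applyUpTo⁺ (f ∘ suc) n (λ j j<n → h (suc j) (s≤s j<n)))

      any-applyUpTo⁻ : ∀ (f : ℕ → ℕ) n → any p (applyUpTo f n) ≡ true → Σ ℕ (λ j → j < n × p (f j) ≡ true)
      any-applyUpTo⁻ f (suc n) e with ∨-true⇒ e
      ... | inj₁ h = 0 , s≤s z≤n , h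
      ... | inj₂ h with any-applyUpTo⁻ (f ∘ suc) n h
      ... | j , j<n , h′ = suc j , s≤s j<n , h′

      any-applyUpTo⁺ : ∀ (f : ℕ → ℕ) n j → j < n → p (f j) ≡ true → any p (applyUpTo f n) ≡ true
      any-applyUpTo⁺ f (suc n) zero    _         h = ∨-trueˡ _ h
      any-applyUpTo⁺ f (suc n) (suc j) (s≤s j<n) h = ∨-trueʳ (p (f 0)) (any-applyUpTo⁺ (f ∘ suc) n j j<n h)

    all<⁻ : ∀ n → all p (upTo n) ≡ true → ∀ j → j < n → p j ≡ true
    all<⁻ = all-applyUpTo⁻ (λ x → x)

    all<⁺ : ∀ n → (∀ j → j < n → p j ≡ true) → all p (upTo n) ≡ true
    all<⁺ = all-applyUpTo⁺ (λ x → x)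

    any<⁻ : ∀ n → any p (upTo n) ≡ true → Σ ℕ (λ j → j < n × p j ≡ true)
    any<⁻ = any-applyUpTo⁻ (λ x → x)

    any<⁺ : ∀ n j → j < n → p j ≡ true → any p (upTo n) ≡ true
    any<⁺ = any-applyUpTo⁺ (λ x → x)

  entry-zero : ∀ {m} (v : Vec ℤ m) → entry v 0 ≡ + 0
  entry-zero []      = refl
  entry-zero (x ∷ v) = refl

  entry-∷ʳ : ∀ {m} (v : Vec ℤ m) a j → entry (v ∷ʳ a) j ≡ (if j ≡ᵇ suc m then a else entry v j)
  entry-∷ʳ []      a zero          = refl
  entry-∷ʳ []      a (suc zero)    = refl
  entry-∷ʳ []      a (suc (suc j)) = refl
  entry-∷ʳ (x ∷ v) a zero          = refl
  entry-∷ʳ (x ∷ v) a (suc zero)    = refl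
  entry-∷ʳ (x ∷ v) a (suc (suc j)) = entry-∷ʳ v a (suc j)

  entry-setAt : ∀ {m} (v : Vec ℤ m) j y i → j < m → entry (setAt v j y) i ≡ (if i ≡ᵇ suc j then y else entry v i)
  entry-setAt (x ∷ v)      zero    y zero          _         = refl
  entry-setAt (x ∷ v)      zero    y (suc zero)    _         = refl
  entry-setAt (x ∷ v)      zero    y (suc (suc i)) _         = refl
  entry-setAt (x ∷ v)      (suc j) y zero          _         = refl
  entry-setAt (x ∷ v)      (suc j) y (suc zero)    _         = refl
  entry-setAt (x ∷ [])     (suc j) y (suc (suc i)) (s≤s ())
  entry-setAt (x ∷ x′ ∷ v) (suc j) y (suc (suc i)) (s≤s j<m) = entry-setAt (x′ ∷ v) j y (suc i) j<m

  entry-insertAt : ∀ {m} (v : Vec ℤ m) j x i → j ≤ m →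
    entry (insertAt v j x) i ≡ (if i <ᵇ suc j then entry v i else if i ≡ᵇ suc j then x else entry v (i ∸ 1))
  entry-insertAt v        zero          x zero                _         = sym (entry-zero v)
  entry-insertAt v        zero          x (suc zero)          _         = refl
  entry-insertAt []       zero          x (suc (suc i))       _         = refl
  entry-insertAt (x′ ∷ v) zero          x (suc (suc i))       _         = refl
  entry-insertAt (x′ ∷ v) (suc j)       x zero                _         = refl
  entry-insertAt (x′ ∷ v) (suc j)       x (suc zero)          _         = refl
  entry-insertAt (x′ ∷ v) (suc zero)    x (suc (suc zero))    _         = refl
  entry-insertAt (x′ ∷ []) (suc (suc j)) x (suc (suc zero))   (s≤s ())
  entry-insertAt (x′ ∷ y ∷ v) (suc (suc j)) x (suc (suc zero)) _        = refl
  entry-insertAt (x′ ∷ v) (suc j)       x (suc (suc (suc i))) (s≤s j≤m) = entry-insertAt v j x (suc (suc i)) j≤m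

  -- `entry v 0` is the junk value + 0, hence the hypothesis on φ.
  entry-map : ∀ {m} (φ : ℤ → ℤ) → φ (+ 0) ≡ + 0 → (v : Vec ℤ m) → ∀ i → entry (Vec.map φ v) i ≡ φ (entry v i)
  entry-map φ e []      i             = sym e
  entry-map φ e (x ∷ v) zero          = sym e
  entry-map φ e (x ∷ v) (suc zero)    = refl
  entry-map φ e (x ∷ v) (suc (suc i)) = entry-map φ e v (suc i)

  entry-All : ∀ {m} {P : ℤ → Set} {v : Vec ℤ m} → Vecᴬ.All P v → ∀ j → j < m → P (entry v (suc j))
  entry-All (p Vecᴬ.∷ ps) zero    _         = p
  entry-All (p Vecᴬ.∷ ps) (suc j) (s≤s j<m) = entry-All ps j j<m

  countᵇ-entry : ∀ {m} (p : ℤ → Bool) (v : Vec ℤ m) → countᵇ p v ≡ ∑< m (λ i → χ (p (entry v (suc i))))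
  countᵇ-entry p []              = refl
  countᵇ-entry {suc m} p (x ∷ v) = trans (cong (_+_ (χ (p x))) (countᵇ-entry p v)) (sym (∑<-sucˡ m _))

  InRangeᶠ : ℕ → (ℕ → ℤ) → Set
  InRangeᶠ m f = ∀ j → j < m → InRange m (f (suc j))

  ∣∣≡suc-pred : ∀ {x} → 1 ≤ ∣ x ∣ → ∣ x ∣ ≡ suc (∣ x ∣ ∸ 1)
  ∣∣≡suc-pred {x} 1≤ = trans (sym (m∸n+n≡m {∣ x ∣} {1} 1≤)) (+-comm (∣ x ∣ ∸ 1) 1)

  multiplicity : ℕ → (ℕ → ℤ) → ℕ → ℕ
  multiplicity m f v = ∑< m (λ i → χ (∣ f (suc i) ∣ ≡ᵇ v))

  isSignedPerm-surjective : ∀ m f → isSignedPermᶠ m f ≡ true → ∀ v → v < m → Σ ℕ (λ i → i < m × ∣ f (suc i) ∣ ≡ suc v)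
  isSignedPerm-surjective m f P v v<m with any<⁻ _ m (all<⁻ _ m P v v<m)
  ... | i , i<m , e = i , i<m , ⌊⌋-sound (∣ f (suc i) ∣ ℕ.≟ suc v) e

  module _ (m : ℕ) (f : ℕ → ℤ) (R : InRangeᶠ m f) where

    ∑<-at-∣∣ : ∀ i → i < m → (H : ℕ → ℕ) → ∑< m (λ v → χ (∣ f (suc i) ∣ ≡ᵇ suc v) * H v) ≡ H (∣ f (suc i) ∣ ∸ 1)
    ∑<-at-∣∣ i i<m H with ∣ f (suc i) ∣ | proj₁ (R i i<m) | proj₂ (R i i<m)
    ... | suc x | _ | x<m = ∑<-indicator m x H x<m

    ∑-multiplicity : ∑< m (λ v → multiplicity m f (suc v)) ≡ m
    ∑-multiplicity = begin
      ∑< m (λ v → ∑< m (λ i → χ (∣ f (suc i) ∣ ≡ᵇ suc v)))   ≡⟨ ∑-swap (upTo m) (upTo m) (λ v i → χ (∣ f (suc i) ∣ ≡ᵇ suc v)) ⟩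
      ∑< m (λ i → ∑< m (λ v → χ (∣ f (suc i) ∣ ≡ᵇ suc v)))   ≡⟨ ∑<-cong m (λ i i<m → trans (∑-cong (upTo m) (λ v → sym (*-identityʳ _))) (∑<-at-∣∣ i i<m (λ _ → 1))) ⟩
      ∑< m (λ _ → 1)                                         ≡⟨ trans (∑<-const m 1) (*-identityʳ m) ⟩
      m                                                      ∎
      where open ≡-Reasoning

    module _ (P : isSignedPermᶠ m f ≡ true) where

      multiplicity≡1 : ∀ v → v < m → multiplicity m f (suc v) ≡ 1
      multiplicity≡1 = ∑<-positive-tight m positive (≤-reflexive ∑-multiplicity)
        where
        positive : ∀ v → v < m → 1 ≤ multiplicity m f (suc v)
        positive v v<m with isSignedPerm-surjective m f P v v<m
        ... | i , i<m , e = subst (λ b → χ b ≤ multiplicity m f (suc v)) (≡ᵇ-≡ e)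
          (subst (_ ≤_) (sym (∑<-erase m i _ i<m)) (m≤n+m _ _))

      isSignedPerm-injective : ∀ i j → i < m → j < m → ∣ f (suc i) ∣ ≡ ∣ f (suc j) ∣ → i ≡ j
      isSignedPerm-injective i j i<m j<m e with i ≟ j
      ... | yes i≡j = i≡j
      ... | no  i≢j = ⊥-elim (<-irrefl refl (subst (2 ≤_) (multiplicity≡1 v v<m) two≤))
        where
        v = ∣ f (suc i) ∣ ∸ 1
        x≡1+v : ∣ f (suc i) ∣ ≡ suc v
        x≡1+v = ∣∣≡suc-pred {f (suc i)} (proj₁ (R i i<m))
        v<m : v < m
        v<m = subst (_≤ m) x≡1+v (proj₂ (R i i<m))
        g = λ k → χ (∣ f (suc k) ∣ ≡ᵇ suc v)
        r = ∑< m (erase i (erase j g))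
        two≤ : 2 ≤ multiplicity m f (suc v)
        two≤ = subst (2 ≤_) (sym (∑<-erase₂ m g i j i<m j<m i≢j))
          (subst₂ (λ a b → 2 ≤ r + a + b) (sym (cong χ (≡ᵇ-≡ x≡1+v))) (sym (cong χ (≡ᵇ-≡ (trans (sym e) x≡1+v))))
            (subst (2 ≤_) (sym (+-assoc r 1 1)) (m≤n+m 2 r)))

      ∑<-reindex : ∀ H → ∑< m (λ p → H (∣ f (suc p) ∣ ∸ 1)) ≡ ∑< m H
      ∑<-reindex H = begin
        ∑< m (λ p → H (∣ f (suc p) ∣ ∸ 1))                       ≡⟨ ∑<-cong m (λ p p<m → sym (∑<-at-∣∣ p p<m H)) ⟩
        ∑< m (λ p → ∑< m (λ v → χ (∣ f (suc p) ∣ ≡ᵇ suc v) * H v)) ≡⟨ ∑-swap (upTo m) (upTo m) (λ p v → χ (∣ f (suc p) ∣ ≡ᵇ suc v) * H v) ⟩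
        ∑< m (λ v → ∑< m (λ p → χ (∣ f (suc p) ∣ ≡ᵇ suc v) * H v)) ≡⟨ ∑-cong (upTo m) (λ v → ∑-*ʳ (upTo m) (λ p → χ (∣ f (suc p) ∣ ≡ᵇ suc v)) (H v)) ⟩
        ∑< m (λ v → multiplicity m f (suc v) * H v)              ≡⟨ ∑<-cong m (λ v v<m → trans (cong (_* H v) (multiplicity≡1 v v<m)) (+-identityʳ (H v))) ⟩
        ∑< m H                                                   ∎
        where open ≡-Reasoning

  ∣∣≤⇒<+ : ∀ {a m} → ∣ a ∣ ≤ m → a ℤ.< + suc m
  ∣∣≤⇒<+ {+ k}      le = ℤ.+<+ (s≤s le)
  ∣∣≤⇒<+ { -[1+ k ]} le = ℤ.-<+

  ∣∣≤⇒>- : ∀ {a m} → ∣ a ∣ ≤ m → -[1+ m ] ℤ.< a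
  ∣∣≤⇒>- {+ k}      le = ℤ.-<+
  ∣∣≤⇒>- { -[1+ k ]} le = ℤ.-<- le

  ≟-neg-false : ∀ x k → ∣ x ∣ ≢ k → ⌊ x ℤ.≟ - (+ k) ⌋ ≡ false
  ≟-neg-false x k ne = ⌊⌋-false (x ℤ.≟ - (+ k)) (λ e → ne (trans (cong ∣_∣ e) (ℤ.∣-i∣≡∣i∣ (+ k))))

  isExcᶠ-by-values : ∀ (g : ℕ → ℤ) i {x z} → g i ≡ x → g ∣ x ∣ ≡ z → isExcᶠ g i ≡ (⌊ x ℤ.≟ - (+ i) ⌋ ∨ ⌊ x ℤ.<? z ⌋)
  isExcᶠ-by-values g i refl refl = refl

  isExcᶠ-fixed : ∀ (g : ℕ → ℤ) i → g (suc i) ≡ + suc i → isExcᶠ g (suc i) ≡ false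
  isExcᶠ-fixed g i e = trans (isExcᶠ-by-values g (suc i) e e)
    (cong₂ _∨_ (⌊⌋-false (+ suc i ℤ.≟ - (+ suc i)) (λ ())) (⌊⌋-false (+ suc i ℤ.<? + suc i) (ℤ.<-irrefl refl)))

  isExcᶠ-cong : ∀ {g h : ℕ → ℤ} → (∀ i → g i ≡ h i) → ∀ i → isExcᶠ g i ≡ isExcᶠ h i
  isExcᶠ-cong {g} {h} eq i = isExcᶠ-by-values g i (eq i) (eq _)

  inRangeᵇ : ℕ → ℤ → Bool
  inRangeᵇ n x = ⌊ 1 ℕ.≤? ∣ x ∣ ⌋ ∧ ⌊ ∣ x ∣ ℕ.≤? n ⌋

  allInRangeᵇ : ℕ → (ℕ → ℤ) → Bool
  allInRangeᵇ n f = all (λ i → inRangeᵇ n (f (suc i))) (upTo n)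

  allInRangeᵇ-sound : ∀ n f → allInRangeᵇ n f ≡ true → InRangeᶠ n f
  allInRangeᵇ-sound n f e j j<n = let h = all<⁻ _ n e j j<n in
    ⌊⌋-sound (1 ℕ.≤? ∣ f (suc j) ∣) (𝔹.∧-conicalˡ _ _ h) , ⌊⌋-sound (∣ f (suc j) ∣ ℕ.≤? n) (𝔹.∧-conicalʳ _ _ h)

  allInRangeᵇ-complete : ∀ n f → InRangeᶠ n f → allInRangeᵇ n f ≡ true
  allInRangeᵇ-complete n f R = all<⁺ _ n (λ j j<n → ∧-true (⌊⌋-true (1 ℕ.≤? _) (proj₁ (R j j<n))) (⌊⌋-true (_ ℕ.≤? n) (proj₂ (R j j<n))))

  isDerangementExceptᶠ : ℕ → ℕ → (ℕ → ℤ) → Bool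
  isDerangementExceptᶠ m j f = all (λ i → (i ≡ᵇ j) ∨ not ⌊ f (suc i) ℤ.≟ + suc i ⌋) (upTo m)

  isFixedᶠ : ℕ → (ℕ → ℤ) → Bool
  isFixedᶠ j f = ⌊ f (suc j) ℤ.≟ + suc j ⌋

  top : ℕ → Bool → ℤ
  top m s = if s then + suc m else -[1+ m ]

  ∣top∣ : ∀ m s → ∣ top m s ∣ ≡ suc m
  ∣top∣ m true  = refl
  ∣top∣ m false = refl

  top<?-below : ∀ m s {a} → ∣ a ∣ ≤ m → ⌊ top m s ℤ.<? a ⌋ ≡ not s
  top<?-below m true  le = ⌊⌋-false (_ ℤ.<? _) (ℤ.<-asym (∣∣≤⇒<+ le))
  top<?-below m false le = ⌊⌋-true  (_ ℤ.<? _) (∣∣≤⇒>- le)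

  below<?-top : ∀ m s {a} → ∣ a ∣ ≤ m → ⌊ a ℤ.<? top m s ⌋ ≡ s
  below<?-top m true  le = ⌊⌋-true  (_ ℤ.<? _) (∣∣≤⇒<+ le)
  below<?-top m false le = ⌊⌋-false (_ ℤ.<? _) (ℤ.<-asym (∣∣≤⇒>- le))

  ∑<-if : ∀ m (b : ℕ → Bool) A B → ∑< m (λ p → if b p then A else B) + ∑< m (χ ∘ b) * B ≡ ∑< m (χ ∘ b) * A + m * B
  ∑<-if zero    b A B = refl
  ∑<-if (suc m) b A B rewrite ∑<-suc m (λ p → if b p then A else B) | ∑<-suc m (χ ∘ b) with b m
  ... | true = trans (shuffle (∑< m (λ p → if b p then A else B)) (∑< m (χ ∘ b)) A B)
    (trans (cong (λ z → z + A + B) (∑<-if m b A B)) (collect (∑< m (χ ∘ b)) m A B))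
    where
    shuffle : ∀ x e A B → x + A + (e + 1) * B ≡ x + e * B + A + B
    shuffle = solve-∀
    collect : ∀ e m A B → e * A + m * B + A + B ≡ (e + 1) * A + suc m * B
    collect = solve-∀
  ... | false = trans (shuffle (∑< m (λ p → if b p then A else B)) (∑< m (χ ∘ b)) B)
    (trans (cong (_+ B) (∑<-if m b A B)) (collect (∑< m (χ ∘ b)) m A B))
    where
    shuffle : ∀ x e B → x + B + (e + 0) * B ≡ x + e * B + B
    shuffle = solve-∀
    collect : ∀ e m A B → e * A + m * B + B ≡ (e + 0) * A + suc m * B
    collect = solve-∀

  *-χ-≡ᵇ : ∀ e c → e * χ (e ≡ᵇ c) ≡ c * χ (e ≡ᵇ c)
  *-χ-≡ᵇ e c with e ≡ᵇ c in eq
  ... | true  = cong (_* 1) (≡ᵇ-sound e c eq)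
  ... | false = trans (*-zeroʳ e) (sym (*-zeroʳ c))

  module _ {g h : ℕ → ℤ} (g≗h : ∀ i → g i ≡ h i) where
    excᶠ-cong : ∀ n → excᶠ n g ≡ excᶠ n h
    excᶠ-cong n = ∑-cong (upTo n) (λ i → cong χ (isExcᶠ-cong g≗h (suc i)))

    isSignedPermᶠ-cong : ∀ n → isSignedPermᶠ n g ≡ isSignedPermᶠ n h
    isSignedPermᶠ-cong n = all-cong (upTo n) (λ j → any-cong (upTo n) (λ i → cong (λ z → ⌊ ∣ z ∣ ℕ.≟ suc j ⌋) (g≗h (suc i))))

    isDerangementᶠ-cong : ∀ n → isDerangementᶠ n g ≡ isDerangementᶠ n h
    isDerangementᶠ-cong n = all-cong (upTo n) (λ i → cong (λ z → not ⌊ z ℤ.≟ + suc i ⌋) (g≗h (suc i)))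

    allInRangeᵇ-cong : ∀ n → allInRangeᵇ n g ≡ allInRangeᵇ n h
    allInRangeᵇ-cong n = all-cong (upTo n) (λ i → cong (inRangeᵇ n) (g≗h (suc i)))

    inD-cong : ∀ n k → inD n k g ≡ inD n k h
    inD-cong n k = cong₂ _∧_ (isSignedPermᶠ-cong n) (cong₂ _∧_ (isDerangementᶠ-cong n) (cong (_≡ᵇ k) (excᶠ-cong n)))

  isDerangementExcept-nonfixed : ∀ m j f → isFixedᶠ j f ≡ false → isDerangementExceptᶠ m j f ≡ isDerangementᶠ m f
  isDerangementExcept-nonfixed m j f fx = all-cong (upTo m) drop-j
    where
    drop-j : ∀ i → ((i ≡ᵇ j) ∨ not ⌊ f (suc i) ℤ.≟ + suc i ⌋) ≡ not ⌊ f (suc i) ℤ.≟ + suc i ⌋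
    drop-j i with i ≟ j
    ... | yes refl rewrite ≡ᵇ-refl i | fx = refl
    ... | no i≢j rewrite ≡ᵇ-≢ i≢j = refl

  isDerangement-fixed : ∀ m j f → j < m → isFixedᶠ j f ≡ true → isDerangementᶠ m f ≡ false
  isDerangement-fixed m j f j<m fx with isDerangementᶠ m f in eq
  ... | false = refl
  ... | true  = ⊥-elim (true≢false fx (𝔹.not-injective (all<⁻ _ m eq j j<m)))

  module Displaced (m : ℕ) (f : ℕ → ℤ) (R : InRangeᶠ m f) (s : Bool) where
    y : ℤ
    y = top m s

    -- `displace` in one-line notation: y in place j+1 and f (j+1) appended in place m+1.
    f′ : ℕ → ℕ → ℤ
    f′ j i = if i ≡ᵇ suc m then f (suc j) else (if i ≡ᵇ suc j then y else f i)

    private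
      f′-last : ∀ j → f′ j (suc m) ≡ f (suc j)
      f′-last j rewrite ≡ᵇ-refl m = refl

      f′-at : ∀ j → j < m → f′ j (suc j) ≡ y
      f′-at j j<m rewrite ≡ᵇ-≢ {suc j} {suc m} (<⇒≢ j<m ∘ suc-injective) | ≡ᵇ-refl j = refl

      f′-other : ∀ j i → i ≢ suc m → i ≢ suc j → f′ j i ≡ f i
      f′-other j i i≢1+m i≢1+j rewrite ≡ᵇ-≢ i≢1+m | ≡ᵇ-≢ i≢1+j = refl

      ∣f∣≤ : ∀ i → i < m → ∣ f (suc i) ∣ ≤ m
      ∣f∣≤ i i<m = proj₂ (R i i<m)

      ≢1+ : ∀ {i} → i < m → suc i ≢ suc m
      ≢1+ i<m = <⇒≢ i<m ∘ suc-injective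

    f′-InRange : ∀ j → j < m → InRangeᶠ (suc m) (f′ j)
    f′-InRange j j<m i i<1+m with i ≟ m | i ≟ j
    ... | yes refl | _ = subst (InRange (suc i)) (sym (f′-last j)) (proj₁ (R j j<m) , m≤n⇒m≤1+n (∣f∣≤ j j<m))
    ... | no i≢m | yes refl = subst (InRange (suc m)) (sym (f′-at i j<m))
      (subst (1 ≤_) (sym (∣top∣ m s)) (s≤s z≤n) , ≤-reflexive (∣top∣ m s))
    ... | no i≢m | no i≢j = subst (InRange (suc m)) (sym (f′-other j (suc i) (i≢m ∘ suc-injective) (i≢j ∘ suc-injective)))
      (let r = R i (≤∧≢⇒< (≤-pred i<1+m) i≢m) in proj₁ r , m≤n⇒m≤1+n (proj₂ r))

    f′-isSignedPerm : ∀ j → j < m → isSignedPermᶠ (suc m) (f′ j) ≡ isSignedPermᶠ m f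
    f′-isSignedPerm j j<m = ≡-by-true to from
      where
      to : isSignedPermᶠ (suc m) (f′ j) ≡ true → isSignedPermᶠ m f ≡ true
      to P′ = all<⁺ _ m (λ v v<m → hit v v<m (any<⁻ _ (suc m) (all<⁻ _ (suc m) P′ v (m<n⇒m<1+n v<m))))
        where
        hit : ∀ v → v < m → Σ ℕ (λ i → i < suc m × ⌊ ∣ f′ j (suc i) ∣ ℕ.≟ suc v ⌋ ≡ true) → any (λ i → ⌊ ∣ f (suc i) ∣ ℕ.≟ suc v ⌋) (upTo m) ≡ true
        hit v v<m (i , i<1+m , h) with i ≟ m | i ≟ j
        ... | yes refl | _ = any<⁺ _ m j j<m (subst (λ z → ⌊ ∣ z ∣ ℕ.≟ suc v ⌋ ≡ true) (f′-last j) h)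
        ... | no i≢m | yes refl = ⊥-elim (<-irrefl (suc-injective (trans (sym (trans (sym (cong ∣_∣ (f′-at i j<m))) (⌊⌋-sound (_ ℕ.≟ _) h))) (∣top∣ m s))) v<m)
        ... | no i≢m | no i≢j = any<⁺ _ m i (≤∧≢⇒< (≤-pred i<1+m) i≢m)
          (subst (λ z → ⌊ ∣ z ∣ ℕ.≟ suc v ⌋ ≡ true) (f′-other j (suc i) (i≢m ∘ suc-injective) (i≢j ∘ suc-injective)) h)
      from : isSignedPermᶠ m f ≡ true → isSignedPermᶠ (suc m) (f′ j) ≡ true
      from P = all<⁺ _ (suc m) hit
        where
        hit : ∀ v → v < suc m → any (λ i → ⌊ ∣ f′ j (suc i) ∣ ℕ.≟ suc v ⌋) (upTo (suc m)) ≡ true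
        hit v v<1+m with v ≟ m
        ... | yes refl = any<⁺ _ (suc m) j (m<n⇒m<1+n j<m) (⌊⌋-true (_ ℕ.≟ _) (trans (cong ∣_∣ (f′-at j j<m)) (∣top∣ m s)))
        ... | no v≢m with isSignedPerm-surjective m f P v (≤∧≢⇒< (≤-pred v<1+m) v≢m)
        ... | i , i<m , e with i ≟ j
        ... | yes refl = any<⁺ _ (suc m) m (n<1+n m) (⌊⌋-true (_ ℕ.≟ _) (trans (cong ∣_∣ (f′-last i)) e))
        ... | no i≢j = any<⁺ _ (suc m) i (m<n⇒m<1+n i<m)
          (⌊⌋-true (_ ℕ.≟ _) (trans (cong ∣_∣ (f′-other j (suc i) (≢1+ i<m) (i≢j ∘ suc-injective))) e))

    private
      ≢pos : ∀ x k → ∣ x ∣ ≢ k → not ⌊ x ℤ.≟ + k ⌋ ≡ true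
      ≢pos x k ne = cong not (⌊⌋-false (x ℤ.≟ + k) (ne ∘ cong ∣_∣))

    f′-isDerangement : ∀ j → j < m → isDerangementᶠ (suc m) (f′ j) ≡ isDerangementExceptᶠ m j f
    f′-isDerangement j j<m = ≡-by-true to from
      where
      to : isDerangementᶠ (suc m) (f′ j) ≡ true → isDerangementExceptᶠ m j f ≡ true
      to D = all<⁺ _ m fix
        where
        fix : ∀ i → i < m → ((i ≡ᵇ j) ∨ not ⌊ f (suc i) ℤ.≟ + suc i ⌋) ≡ true
        fix i i<m with i ≟ j
        ... | yes refl = ∨-trueˡ _ (≡ᵇ-refl i)
        ... | no i≢j = ∨-trueʳ (i ≡ᵇ j) (subst (λ z → not ⌊ z ℤ.≟ + suc i ⌋ ≡ true)
          (f′-other j (suc i) (≢1+ i<m) (i≢j ∘ suc-injective)) (all<⁻ _ (suc m) D i (m<n⇒m<1+n i<m)))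
      from : isDerangementExceptᶠ m j f ≡ true → isDerangementᶠ (suc m) (f′ j) ≡ true
      from D = all<⁺ _ (suc m) fix
        where
        fix : ∀ i → i < suc m → not ⌊ f′ j (suc i) ℤ.≟ + suc i ⌋ ≡ true
        fix i i<1+m with i ≟ m | i ≟ j
        ... | yes refl | _ = subst (λ z → not ⌊ z ℤ.≟ + suc i ⌋ ≡ true) (sym (f′-last j)) (≢pos _ _ (λ e → <-irrefl e (s≤s (∣f∣≤ j j<m))))
        ... | no i≢m | yes refl = subst (λ z → not ⌊ z ℤ.≟ + suc i ⌋ ≡ true) (sym (f′-at i j<m))
          (≢pos _ _ (λ e → <-irrefl (suc-injective (trans (sym e) (∣top∣ m s))) j<m))
        ... | no i≢m | no i≢j with ∨-true⇒ (all<⁻ _ m D i (≤∧≢⇒< (≤-pred i<1+m) i≢m))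
        ... | inj₁ e = ⊥-elim (i≢j (≡ᵇ-sound i j e))
        ... | inj₂ e = subst (λ z → not ⌊ z ℤ.≟ + suc i ⌋ ≡ true) (sym (f′-other j (suc i) (i≢m ∘ suc-injective) (i≢j ∘ suc-injective))) e

    module _ (P : isSignedPermᶠ m f ≡ true) (j p : ℕ) (p<m : p < m) (∣fp∣ : ∣ f (suc p) ∣ ≡ suc j) where
      private
        j<m : j < m
        j<m = subst (_≤ m) ∣fp∣ (∣f∣≤ p p<m)

        E E′ : ℕ → ℕ
        E  i = χ (isExcᶠ f (suc i))
        E′ i = χ (isExcᶠ (f′ j) (suc i))

        a = f (suc j)

        p≡ : ∀ {i} → i < m → ∣ f (suc i) ∣ ≡ suc j → i ≡ p
        p≡ {i} i<m e = isSignedPerm-injective m f R P i p i<m p<m (trans e (sym ∣fp∣))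

        E′-other : ∀ i → i < m → i ≢ p → i ≢ j → E′ i ≡ E i
        E′-other i i<m i≢p i≢j = cong χ (trans
          (isExcᶠ-by-values (f′ j) (suc i) (f′-other j (suc i) (≢1+ i<m) (i≢j ∘ suc-injective))
            (f′-other j ∣ f (suc i) ∣ (λ e → <-irrefl e (s≤s (∣f∣≤ i i<m))) (i≢p ∘ p≡ i<m)))
          (sym (isExcᶠ-by-values f (suc i) refl refl)))

        E′-j : E′ j ≡ χ (not s)
        E′-j = cong χ (trans (isExcᶠ-by-values (f′ j) (suc j) (f′-at j j<m) (trans (cong (f′ j) (∣top∣ m s)) (f′-last j)))
          (cong₂ _∨_ (≟-neg-false y (suc j) (λ e → <-irrefl (suc-injective (trans (sym e) (∣top∣ m s))) j<m)) (top<?-below m s (∣f∣≤ j j<m))))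

        E′-last-p≡j : p ≡ j → E′ m ≡ χ s
        E′-last-p≡j refl = cong χ (trans (isExcᶠ-by-values (f′ p) (suc m) (f′-last p) (trans (cong (f′ p) ∣fp∣) (f′-at p j<m)))
          (cong₂ _∨_ (≟-neg-false a (suc m) (λ e → <-irrefl e (s≤s (∣f∣≤ p p<m)))) (below<?-top m s (∣f∣≤ p p<m))))

        E′-last-p≢j : p ≢ j → E′ m ≡ E j
        E′-last-p≢j p≢j = cong χ (trans
          (isExcᶠ-by-values (f′ j) (suc m) (f′-last j) (f′-other j ∣ a ∣ (λ e → <-irrefl e (s≤s (∣f∣≤ j j<m))) (λ e → p≢j (sym (p≡ j<m e)))))
          (trans (cong (_∨ ⌊ a ℤ.<? f ∣ a ∣ ⌋) (trans (≟-neg-false a (suc m) (λ e → <-irrefl e (s≤s (∣f∣≤ j j<m))))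
                                                     (sym (≟-neg-false a (suc j) (λ e → p≢j (sym (p≡ j<m e)))))))
                 (sym (isExcᶠ-by-values f (suc j) refl refl))))

        E′-p : p ≢ j → E′ p ≡ χ s
        E′-p p≢j = cong χ (trans (isExcᶠ-by-values (f′ j) (suc p) (f′-other j (suc p) (≢1+ p<m) (p≢j ∘ suc-injective)) (trans (cong (f′ j) ∣fp∣) (f′-at j j<m)))
          (cong₂ _∨_ (≟-neg-false (f (suc p)) (suc p) (λ e → p≢j (suc-injective (trans (sym e) ∣fp∣)))) (below<?-top m s (∣f∣≤ p p<m))))

      -- Only the places p+1, j+1 and m+1 can change their excedance status.
      f′-exc : excᶠ (suc m) (f′ j) + E p ≡ excᶠ m f + 1
      f′-exc with p ≟ j
      ... | yes refl = begin
        ∑< (suc m) E′ + E p                                 ≡⟨ cong (_+ E p) (∑<-suc m E′) ⟩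
        ∑< m E′ + E′ m + E p                                ≡⟨ cong (λ z → z + E′ m + E p) (∑<-erase m p E′ p<m) ⟩
        ∑< m (erase p E′) + E′ p + E′ m + E p               ≡⟨ cong₃ rest E′-j (E′-last-p≡j refl) ⟩
        ∑< m (erase p E) + χ (not s) + χ s + E p            ≡⟨ cong (_+ E p) (+-assoc (∑< m (erase p E)) (χ (not s)) (χ s)) ⟩
        ∑< m (erase p E) + (χ (not s) + χ s) + E p          ≡⟨ cong (λ z → ∑< m (erase p E) + z + E p) (χ-not+χ s) ⟩
        ∑< m (erase p E) + 1 + E p                          ≡⟨ +-right-comm (∑< m (erase p E)) 1 (E p) ⟩
        ∑< m (erase p E) + E p + 1                          ≡⟨ cong (_+ 1) (sym (∑<-erase m p E p<m)) ⟩
        ∑< m E + 1                                          ∎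
        where
        open ≡-Reasoning
        rest : ∑< m (erase p E′) ≡ ∑< m (erase p E)
        rest = ∑<-cong m (λ i i<m → erase-cong p {E′} {E} i (λ i≢p → E′-other i i<m i≢p i≢p))
        cong₃ : ∀ {a a′ b b′ c c′ d : ℕ} → a ≡ a′ → b ≡ b′ → c ≡ c′ → a + b + c + d ≡ a′ + b′ + c′ + d
        cong₃ refl refl refl = refl
      ... | no p≢j = begin
        ∑< (suc m) E′ + E p                                 ≡⟨ cong (_+ E p) (∑<-suc m E′) ⟩
        ∑< m E′ + E′ m + E p                                ≡⟨ cong (λ z → z + E′ m + E p) (∑<-erase₂ m E′ p j p<m j<m p≢j) ⟩
        ∑< m (erase p (erase j E′)) + E′ p + E′ j + E′ m + E p ≡⟨ cong₄ rest (E′-p p≢j) E′-j (E′-last-p≢j p≢j) ⟩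
        ∑< m (erase p (erase j E)) + χ s + χ (not s) + E j + E p
          ≡⟨ rearrange (∑< m (erase p (erase j E))) (χ s) (χ (not s)) (E j) (E p) ⟩
        ∑< m (erase p (erase j E)) + E p + E j + (χ (not s) + χ s)
          ≡⟨ cong (_+_ (∑< m (erase p (erase j E)) + E p + E j)) (χ-not+χ s) ⟩
        ∑< m (erase p (erase j E)) + E p + E j + 1          ≡⟨ cong (_+ 1) (sym (∑<-erase₂ m E p j p<m j<m p≢j)) ⟩
        ∑< m E + 1                                          ∎
        where
        open ≡-Reasoning
        rest : ∑< m (erase p (erase j E′)) ≡ ∑< m (erase p (erase j E))
        rest = ∑<-cong m (λ i i<m → erase-cong p {erase j E′} {erase j E} i (λ i≢p → erase-cong j {E′} {E} i (E′-other i i<m i≢p)))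
        cong₄ : ∀ {a a′ b b′ c c′ d d′ : ℕ} {e} → a ≡ a′ → b ≡ b′ → c ≡ c′ → d ≡ d′ → a + b + c + d + e ≡ a′ + b′ + c′ + d′ + e
        cong₄ refl refl refl refl = refl
        rearrange : ∀ a b c d e → a + b + c + d + e ≡ a + e + d + (c + b)
        rearrange = solve-∀

    module _ (P : isSignedPermᶠ m f ≡ true) (k : ℕ) where
      private
        e = excᶠ m f
        δₖ₊₁ = χ (e ≡ᵇ suc k)
        δₖ = χ (e ≡ᵇ k)

        by-position : ∀ p → p < m → χ (excᶠ (suc m) (f′ (∣ f (suc p) ∣ ∸ 1)) ≡ᵇ suc k) ≡ (if isExcᶠ f (suc p) then δₖ₊₁ else δₖ)
        by-position p p<m with isExcᶠ f (suc p) in isExc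
        ... | true  = cong (λ z → χ (z ≡ᵇ suc k)) (+-cancelʳ-≡ 1 _ _ (subst (λ b → excᶠ (suc m) (f′ j) + χ b ≡ e + 1) isExc shift))
          where
          j = ∣ f (suc p) ∣ ∸ 1
          shift = f′-exc P j p p<m (∣∣≡suc-pred {f (suc p)} (proj₁ (R p p<m)))
        ... | false = cong (λ z → χ (z ≡ᵇ suc k)) (trans (sym (+-identityʳ _))
          (trans (subst (λ b → excᶠ (suc m) (f′ j) + χ b ≡ e + 1) isExc shift) (+-comm e 1)))
          where
          j = ∣ f (suc p) ∣ ∸ 1
          shift = f′-exc P j p p<m (∣∣≡suc-pred {f (suc p)} (proj₁ (R p p<m)))

      -- Reindexing j by the p with |f (p+1)| = j+1 (f′-exc) gives e [e = k+1] + (m − e) [e = k]; the term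
      -- k [e = k] is moved to the left so that no truncated subtraction occurs.
      ∑-f′-exc : ∑< m (λ j → χ (excᶠ (suc m) (f′ j) ≡ᵇ suc k)) + k * δₖ ≡ suc k * δₖ₊₁ + m * δₖ
      ∑-f′-exc = begin
        ∑< m (λ j → χ (excᶠ (suc m) (f′ j) ≡ᵇ suc k)) + k * δₖ
          ≡⟨ cong₂ _+_ (sym (∑<-reindex m f R P (λ j → χ (excᶠ (suc m) (f′ j) ≡ᵇ suc k)))) (sym (*-χ-≡ᵇ e k)) ⟩
        ∑< m (λ p → χ (excᶠ (suc m) (f′ (∣ f (suc p) ∣ ∸ 1)) ≡ᵇ suc k)) + e * δₖ
          ≡⟨ cong (_+ e * δₖ) (∑<-cong m by-position) ⟩
        ∑< m (λ p → if isExcᶠ f (suc p) then δₖ₊₁ else δₖ) + e * δₖ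
          ≡⟨ ∑<-if m (λ p → isExcᶠ f (suc p)) δₖ₊₁ δₖ ⟩
        e * δₖ₊₁ + m * δₖ
          ≡⟨ cong (_+ m * δₖ) (*-χ-≡ᵇ e (suc k)) ⟩
        suc k * δₖ₊₁ + m * δₖ
          ∎
        where open ≡-Reasoning

  -- The range test makes 𝟙D vanish on every vector repeating an absolute value, as
  -- ∑-vecsOver-split requires.
  𝟙D : ∀ n → ℕ → Vec ℤ n → ℕ
  𝟙D n k σ = χ (allInRangeᵇ n (entry σ) ∧ inD n k (entry σ))

  onlyFixedAt : ℕ → ℕ → ℕ → (ℕ → ℤ) → Bool
  onlyFixedAt n j k f = isSignedPermᶠ n f ∧ isFixedᶠ j f ∧ isDerangementExceptᶠ n j f ∧ (excᶠ n f ≡ᵇ k)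

  module DisplacedVec (m : ℕ) (w : Vec ℤ m) (R : InRangeᶠ m (entry w)) (k : ℕ) (s : Bool) where
    open Displaced m (entry w) R s

    private
      f = entry w
      c = χ (isSignedPermᶠ m f ∧ isDerangementᶠ m f)
      X = ∑< m (λ j → χ (excᶠ (suc m) (f′ j) ≡ᵇ suc k))

      entry-displace : ∀ j → j < m → ∀ i → entry (displace w j y) i ≡ f′ j i
      entry-displace j j<m i = trans (entry-∷ʳ (setAt w j y) (f (suc j)) i)
        (cong (λ z → if i ≡ᵇ suc m then f (suc j) else z) (entry-setAt w j y i j<m))

      𝟙D-displace : ∀ j → j < m → 𝟙D (suc m) (suc k) (displace w j y) ≡ χ (isSignedPermᶠ m f ∧ isDerangementExceptᶠ m j f ∧ (excᶠ (suc m) (f′ j) ≡ᵇ suc k))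
      𝟙D-displace j j<m = cong χ (begin
        allInRangeᵇ (suc m) (entry v) ∧ inD (suc m) (suc k) (entry v)
          ≡⟨ cong₂ _∧_ (allInRangeᵇ-cong (entry-displace j j<m) (suc m)) (inD-cong (entry-displace j j<m) (suc m) (suc k)) ⟩
        allInRangeᵇ (suc m) (f′ j) ∧ inD (suc m) (suc k) (f′ j)
          ≡⟨ cong (_∧ inD (suc m) (suc k) (f′ j)) (allInRangeᵇ-complete (suc m) (f′ j) (f′-InRange j j<m)) ⟩
        inD (suc m) (suc k) (f′ j)
          ≡⟨ cong₂ _∧_ (f′-isSignedPerm j j<m) (cong (_∧ (excᶠ (suc m) (f′ j) ≡ᵇ suc k)) (f′-isDerangement j j<m)) ⟩
        isSignedPermᶠ m f ∧ isDerangementExceptᶠ m j f ∧ (excᶠ (suc m) (f′ j) ≡ᵇ suc k)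
          ∎)
        where
        open ≡-Reasoning
        v = displace w j y

      split-fixed : ∀ j → j < m → χ (isSignedPermᶠ m f ∧ isDerangementExceptᶠ m j f ∧ (excᶠ (suc m) (f′ j) ≡ᵇ suc k))
                                   ≡ c * χ (excᶠ (suc m) (f′ j) ≡ᵇ suc k) + χ (onlyFixedAt m j k f)
      split-fixed j j<m with isSignedPermᶠ m f in isPerm
      ... | false = refl
      ... | true with isFixedᶠ j f in isFixed
      ... | false rewrite isDerangementExcept-nonfixed m j f isFixed = trans (χ-∧ (isDerangementᶠ m f) _) (sym (+-identityʳ _))
      ... | true rewrite isDerangement-fixed m j f j<m isFixed = cong (λ z → χ (isDerangementExceptᶠ m j f ∧ (z ≡ᵇ suc k))) exc-suc
        where
        f-j : f (suc j) ≡ + suc j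
        f-j = ⌊⌋-sound (f (suc j) ℤ.≟ + suc j) isFixed
        exc-suc : excᶠ (suc m) (f′ j) ≡ suc (excᶠ m f)
        exc-suc = trans (sym (+-identityʳ _)) (trans (subst (λ b → excᶠ (suc m) (f′ j) + χ b ≡ excᶠ m f + 1) (isExcᶠ-fixed f j f-j)
          (f′-exc isPerm j j j<m (cong ∣_∣ f-j))) (+-comm (excᶠ m f) 1))

      ∑-𝟙D-displace : ∑< m (λ j → 𝟙D (suc m) (suc k) (displace w j y)) ≡ c * X + ∑< m (λ j → χ (onlyFixedAt m j k f))
      ∑-𝟙D-displace = trans (∑<-cong m (λ j j<m → trans (𝟙D-displace j j<m) (split-fixed j j<m)))
        (trans (∑-+ (upTo m) (λ j → c * χ (excᶠ (suc m) (f′ j) ≡ᵇ suc k)) (λ j → χ (onlyFixedAt m j k f)))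
          (cong (_+ ∑< m (λ j → χ (onlyFixedAt m j k f))) (∑-*ˡ (upTo m) c _)))

    ∑-𝟙D-displace-count : ∑< m (λ j → 𝟙D (suc m) (suc k) (displace w j y)) + k * χ (inD m k f)
                          ≡ suc k * χ (inD m (suc k) f) + m * χ (inD m k f) + ∑< m (λ j → χ (onlyFixedAt m j k f))
    ∑-𝟙D-displace-count = begin
      ∑< m (λ j → 𝟙D (suc m) (suc k) (displace w j y)) + k * χ (inD m k f)
        ≡⟨ cong₂ (λ a b → a + k * χ b) ∑-𝟙D-displace (sym (𝔹.∧-assoc (isSignedPermᶠ m f) _ _)) ⟩
      c * X + Y + k * χ (b ∧ (e ≡ᵇ k))
        ≡⟨ collect b (λ isD → ∑-f′-exc (𝔹.∧-conicalˡ _ _ isD) k) ⟩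
      suc k * χ (b ∧ (e ≡ᵇ suc k)) + m * χ (b ∧ (e ≡ᵇ k)) + Y
        ≡⟨ cong₂ (λ a a′ → suc k * χ a + m * χ a′ + Y) (𝔹.∧-assoc (isSignedPermᶠ m f) _ _) (𝔹.∧-assoc (isSignedPermᶠ m f) _ _) ⟩
      suc k * χ (inD m (suc k) f) + m * χ (inD m k f) + Y
        ∎
      where
      open ≡-Reasoning
      b = isSignedPermᶠ m f ∧ isDerangementᶠ m f
      e = excᶠ m f
      Y = ∑< m (λ j → χ (onlyFixedAt m j k f))
      collect : ∀ b → (b ≡ true → X + k * χ (e ≡ᵇ k) ≡ suc k * χ (e ≡ᵇ suc k) + m * χ (e ≡ᵇ k)) →
        χ b * X + Y + k * χ (b ∧ (e ≡ᵇ k)) ≡ suc k * χ (b ∧ (e ≡ᵇ suc k)) + m * χ (b ∧ (e ≡ᵇ k)) + Y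
      collect true  h = trans (shuffle X Y (k * χ (e ≡ᵇ k))) (cong (_+ Y) (h refl))
        where
        shuffle : ∀ a b c → (a + 0) + b + c ≡ a + c + b
        shuffle = solve-∀
      collect false _ = zeros Y k (suc k) m
        where
        zeros : ∀ a b c d → a + b * 0 ≡ c * 0 + d * 0 + a
        zeros = solve-∀

  module AppendedNegative (m : ℕ) (f : ℕ → ℤ) (R : InRangeᶠ m f) where
    g : ℕ → ℤ
    g i = if i ≡ᵇ suc m then -[1+ m ] else f i

    private
      g-last : g (suc m) ≡ -[1+ m ]
      g-last rewrite ≡ᵇ-refl m = refl

      g-other : ∀ i → i ≢ suc m → g i ≡ f i
      g-other i i≢1+m rewrite ≡ᵇ-≢ i≢1+m = refl

      ≢1+ : ∀ {i} → i < m → suc i ≢ suc m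
      ≢1+ i<m = <⇒≢ i<m ∘ suc-injective

    g-InRange : InRangeᶠ (suc m) g
    g-InRange i i<1+m with i ≟ m
    ... | yes refl = subst (InRange (suc i)) (sym g-last) (s≤s z≤n , ≤-refl)
    ... | no i≢m = subst (InRange (suc m)) (sym (g-other (suc i) (i≢m ∘ suc-injective)))
      (let r = R i (≤∧≢⇒< (≤-pred i<1+m) i≢m) in proj₁ r , m≤n⇒m≤1+n (proj₂ r))

    g-isSignedPerm : isSignedPermᶠ (suc m) g ≡ isSignedPermᶠ m f
    g-isSignedPerm = ≡-by-true to from
      where
      to : isSignedPermᶠ (suc m) g ≡ true → isSignedPermᶠ m f ≡ true
      to P′ = all<⁺ _ m hit
        where
        hit : ∀ v → v < m → any (λ i → ⌊ ∣ f (suc i) ∣ ℕ.≟ suc v ⌋) (upTo m) ≡ true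
        hit v v<m with any<⁻ _ (suc m) (all<⁻ _ (suc m) P′ v (m<n⇒m<1+n v<m))
        ... | i , i<1+m , h with i ≟ m
        ... | yes refl = ⊥-elim (<-irrefl (suc-injective (trans (sym (⌊⌋-sound (_ ℕ.≟ _) h)) (cong ∣_∣ g-last))) v<m)
        ... | no i≢m = any<⁺ _ m i (≤∧≢⇒< (≤-pred i<1+m) i≢m)
          (subst (λ z → ⌊ ∣ z ∣ ℕ.≟ suc v ⌋ ≡ true) (g-other (suc i) (i≢m ∘ suc-injective)) h)
      from : isSignedPermᶠ m f ≡ true → isSignedPermᶠ (suc m) g ≡ true
      from P = all<⁺ _ (suc m) hit
        where
        hit : ∀ v → v < suc m → any (λ i → ⌊ ∣ g (suc i) ∣ ℕ.≟ suc v ⌋) (upTo (suc m)) ≡ true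
        hit v v<1+m with v ≟ m
        ... | yes refl = any<⁺ _ (suc m) m (n<1+n m) (⌊⌋-true (_ ℕ.≟ _) (cong ∣_∣ g-last))
        ... | no v≢m with isSignedPerm-surjective m f P v (≤∧≢⇒< (≤-pred v<1+m) v≢m)
        ... | i , i<m , e = any<⁺ _ (suc m) i (m<n⇒m<1+n i<m) (⌊⌋-true (_ ℕ.≟ _) (trans (cong ∣_∣ (g-other (suc i) (≢1+ i<m))) e))

    g-isDerangement : isDerangementᶠ (suc m) g ≡ isDerangementᶠ m f
    g-isDerangement = ≡-by-true to from
      where
      to : isDerangementᶠ (suc m) g ≡ true → isDerangementᶠ m f ≡ true
      to D = all<⁺ _ m (λ i i<m → subst (λ z → not ⌊ z ℤ.≟ + suc i ⌋ ≡ true) (g-other (suc i) (≢1+ i<m)) (all<⁻ _ (suc m) D i (m<n⇒m<1+n i<m)))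
      from : isDerangementᶠ m f ≡ true → isDerangementᶠ (suc m) g ≡ true
      from D = all<⁺ _ (suc m) fix
        where
        fix : ∀ i → i < suc m → not ⌊ g (suc i) ℤ.≟ + suc i ⌋ ≡ true
        fix i i<1+m with i ≟ m
        ... | yes refl = subst (λ z → not ⌊ z ℤ.≟ + suc i ⌋ ≡ true) (sym g-last) refl
        ... | no i≢m = subst (λ z → not ⌊ z ℤ.≟ + suc i ⌋ ≡ true) (sym (g-other (suc i) (i≢m ∘ suc-injective))) (all<⁻ _ m D i (≤∧≢⇒< (≤-pred i<1+m) i≢m))

    g-exc : excᶠ (suc m) g ≡ suc (excᶠ m f)
    g-exc = trans (∑<-suc m _) (trans (cong₂ _+_ (∑<-cong m earlier) last-isExc) (+-comm _ 1))
      where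
      earlier : ∀ i → i < m → χ (isExcᶠ g (suc i)) ≡ χ (isExcᶠ f (suc i))
      earlier i i<m = cong χ (trans (isExcᶠ-by-values g (suc i) (g-other (suc i) (≢1+ i<m)) (g-other _ (λ e → <-irrefl e (s≤s (proj₂ (R i i<m))))))
        (sym (isExcᶠ-by-values f (suc i) refl refl)))
      last-isExc : χ (isExcᶠ g (suc m)) ≡ 1
      last-isExc = cong χ (trans (isExcᶠ-by-values g (suc m) g-last refl) (cong (_∨ ⌊ -[1+ m ] ℤ.<? g (suc m) ⌋) (⌊⌋-true (-[1+ m ] ℤ.≟ - (+ suc m)) refl)))

  skip-cases : ∀ j n → (n < j × skip j n ≡ n) ⊎ (j ≤ n × skip j n ≡ suc n)
  skip-cases j n with n <? j
  ... | yes n<j = inj₁ (n<j , skip-< n<j)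
  ... | no  n≮j = inj₂ (≮⇒≥ n≮j , skip-≥ (≮⇒≥ n≮j))

  skip-mono : ∀ j {a b} → a < b → skip j a < skip j b
  skip-mono j {a} {b} a<b with skip-cases j a | skip-cases j b
  ... | inj₁ (_ , ea)   | inj₁ (_ , eb)   rewrite ea | eb = a<b
  ... | inj₁ (_ , ea)   | inj₂ (_ , eb)   rewrite ea | eb = m<n⇒m<1+n a<b
  ... | inj₂ (j≤a , _)  | inj₁ (b<j , _)  = ⊥-elim (<-irrefl refl (<-≤-trans (≤-<-trans j≤a a<b) (<⇒≤ b<j)))
  ... | inj₂ (_ , ea)   | inj₂ (_ , eb)   rewrite ea | eb = s≤s a<b

  skip-≢ : ∀ j n → skip j n ≢ j
  skip-≢ j n e with skip-cases j n
  ... | inj₁ (n<j , en) = <-irrefl (trans (sym en) e) n<j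
  ... | inj₂ (j≤n , en) = <-irrefl (sym (trans (sym en) e)) (s≤s j≤n)

  skip-injective : ∀ j {a b} → skip j a ≡ skip j b → a ≡ b
  skip-injective j {a} {b} e with <-cmp a b
  ... | tri< a<b _ _ = ⊥-elim (<-irrefl e (skip-mono j a<b))
  ... | tri≈ _ a≡b _ = a≡b
  ... | tri> _ _ b<a = ⊥-elim (<-irrefl (sym e) (skip-mono j b<a))

  n≤skip : ∀ j n → n ≤ skip j n
  n≤skip j n with skip-cases j n
  ... | inj₁ (_ , e) = ≤-reflexive (sym e)
  ... | inj₂ (_ , e) = subst (n ≤_) (sym e) (n≤1+n n)

  skip-≤ : ∀ j {n m} → n ≤ m → skip j n ≤ suc m
  skip-≤ j {n} {m} n≤m with skip-cases j n
  ... | inj₁ (_ , e) = subst (_≤ suc m) (sym e) (m≤n⇒m≤1+n n≤m)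
  ... | inj₂ (_ , e) = subst (_≤ suc m) (sym e) (s≤s n≤m)

  suc-skip : ∀ j i → suc (skip j i) ≡ skip (suc j) (suc i)
  suc-skip j i with i <ᵇ j
  ... | true  = refl
  ... | false = refl

  skipᶻ : ℕ → ℤ → ℤ
  skipᶻ j (+ n)      = + skip j n
  skipᶻ j -[1+ n ]   = - (+ skip j (suc n))

  ∣skipᶻ∣ : ∀ j x → ∣ skipᶻ j x ∣ ≡ skip j ∣ x ∣
  ∣skipᶻ∣ j (+ n)    = refl
  ∣skipᶻ∣ j -[1+ n ] = ℤ.∣-i∣≡∣i∣ (+ skip j (suc n))

  skipᶻ-below : ∀ j x → ∣ x ∣ < j → skipᶻ j x ≡ x
  skipᶻ-below j (+ n)    lt = cong +_ (skip-< lt)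
  skipᶻ-below j -[1+ n ] lt = cong (λ z → - (+ z)) (skip-< lt)

  skipᶻ-mono : ∀ j {x z} → x ℤ.< z → skipᶻ j x ℤ.< skipᶻ j z
  skipᶻ-mono j (ℤ.-<- b<a)      = ℤ.neg-mono-< (ℤ.+<+ (skip-mono j (s≤s b<a)))
  skipᶻ-mono j (ℤ.-<+ {a} {b}) with skip j (suc a) | n≤skip j (suc a)
  ... | suc _ | _ = ℤ.-<+
  skipᶻ-mono j (ℤ.+<+ a<b)      = ℤ.+<+ (skip-mono j a<b)

  skipᶻ-mono⁻ : ∀ j {x z} → skipᶻ j x ℤ.< skipᶻ j z → x ℤ.< z
  skipᶻ-mono⁻ j {x} {z} lt with ℤ.<-cmp x z
  ... | tri< x<z _ _ = x<z
  ... | tri≈ _ refl _ = ⊥-elim (ℤ.<-irrefl refl lt)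
  ... | tri> _ _ z<x = ⊥-elim (ℤ.<-asym lt (skipᶻ-mono j z<x))

  skipᶻ-injective : ∀ j {x z} → skipᶻ j x ≡ skipᶻ j z → x ≡ z
  skipᶻ-injective j {x} {z} e with ℤ.<-cmp x z
  ... | tri< x<z _ _ = ⊥-elim (ℤ.<-irrefl e (skipᶻ-mono j x<z))
  ... | tri≈ _ x≡z _ = x≡z
  ... | tri> _ _ z<x = ⊥-elim (ℤ.<-irrefl (sym e) (skipᶻ-mono j z<x))

  ⌊skipᶻ≟skipᶻ⌋ : ∀ j x z → ⌊ skipᶻ j x ℤ.≟ skipᶻ j z ⌋ ≡ ⌊ x ℤ.≟ z ⌋
  ⌊skipᶻ≟skipᶻ⌋ j x z = ⌊⌋-cong-⇔ (skipᶻ j x ℤ.≟ skipᶻ j z) (x ℤ.≟ z) (skipᶻ-injective j) (cong (skipᶻ j))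

  ⌊skipᶻ<?skipᶻ⌋ : ∀ j x z → ⌊ skipᶻ j x ℤ.<? skipᶻ j z ⌋ ≡ ⌊ x ℤ.<? z ⌋
  ⌊skipᶻ<?skipᶻ⌋ j x z = ⌊⌋-cong-⇔ (skipᶻ j x ℤ.<? skipᶻ j z) (x ℤ.<? z) (skipᶻ-mono⁻ j) (skipᶻ-mono j)

  -- Inverse to deleting the fixed point j+1: insert it into u, shifting absolute values ≥ j+1 up.
  module InsertedFixedPoint (t j : ℕ) (j<1+t : j < suc t) (u : Vec ℤ t) where
    private
      g = entry u

    F : ℕ → ℤ
    F = entry (insertAt (Vec.map (skipᶻ (suc j)) u) j (+ suc j))

    private
      F-val : ∀ i → F i ≡ (if i <ᵇ suc j then skipᶻ (suc j) (g i) else if i ≡ᵇ suc j then + suc j else skipᶻ (suc j) (g (i ∸ 1)))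
      F-val i = trans (entry-insertAt (Vec.map (skipᶻ (suc j)) u) j (+ suc j) i (≤-pred j<1+t))
        (cong₂ (λ a b → if i <ᵇ suc j then a else if i ≡ᵇ suc j then + suc j else b) (entry-map (skipᶻ (suc j)) refl u i) (entry-map (skipᶻ (suc j)) refl u (i ∸ 1)))

      F-j : F (suc j) ≡ + suc j
      F-j = trans (F-val (suc j)) (cong₂ (λ a b → if a then skipᶻ (suc j) (g (suc j)) else if b then + suc j else skipᶻ (suc j) (g j)) (<ᵇ-false {suc j} ≤-refl) (≡ᵇ-refl j))

      F-skip : ∀ p → F (skip (suc j) p) ≡ skipᶻ (suc j) (g p)
      F-skip p with skip-cases (suc j) p
      ... | inj₁ (p<1+j , e) rewrite e = trans (F-val p)
        (cong (λ a → if a then skipᶻ (suc j) (g p) else if p ≡ᵇ suc j then + suc j else skipᶻ (suc j) (g (p ∸ 1))) (<ᵇ-true p<1+j))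
      ... | inj₂ (1+j≤p , e) rewrite e = trans (F-val (suc p))
        (cong₂ (λ a b → if a then skipᶻ (suc j) (g (suc p)) else if b then + suc j else skipᶻ (suc j) (g p)) (<ᵇ-false (s≤s (<⇒≤ 1+j≤p))) (≡ᵇ-≢ (<⇒≢ 1+j≤p ∘ sym)))

      F-skip-suc : ∀ i → F (suc (skip j i)) ≡ skipᶻ (suc j) (g (suc i))
      F-skip-suc i = trans (cong F (suc-skip j i)) (F-skip (suc i))

      isExc-F-skip : ∀ p → isExcᶠ F (skip (suc j) (suc p)) ≡ isExcᶠ g (suc p)
      isExc-F-skip p = trans (isExcᶠ-by-values F _ (F-skip (suc p)) (trans (cong F (∣skipᶻ∣ (suc j) (g (suc p)))) (F-skip _)))
        (trans (cong₂ _∨_ (⌊skipᶻ≟skipᶻ⌋ (suc j) (g (suc p)) (- (+ suc p))) (⌊skipᶻ<?skipᶻ⌋ (suc j) (g (suc p)) (g ∣ g (suc p) ∣)))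
          (sym (isExcᶠ-by-values g (suc p) refl refl)))

    F-fixed : isFixedᶠ j F ≡ true
    F-fixed = trans (cong (λ z → ⌊ z ℤ.≟ + suc j ⌋) F-j) (⌊⌋-true (+ suc j ℤ.≟ + suc j) refl)

    F-exc : excᶠ (suc t) F ≡ excᶠ t g
    F-exc = trans (∑<-skip j t _ j<1+t) (trans (cong₂ _+_
      (∑-cong (upTo t) (λ i → cong χ (trans (cong (isExcᶠ F) (suc-skip j i)) (isExc-F-skip i))))
      (cong χ (isExcᶠ-fixed F j F-j))) (+-identityʳ _))

    F-isDerangementExcept : isDerangementExceptᶠ (suc t) j F ≡ isDerangementᶠ t g
    F-isDerangementExcept = trans (AllFold.fold<-skip j t H j<1+t)
      (trans (cong (all (H ∘ skip j) (upTo t) ∧_) (cong (_∨ not ⌊ F (suc j) ℤ.≟ + suc j ⌋) (≡ᵇ-refl j)))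
        (trans (𝔹.∧-identityʳ _) (all-cong (upTo t) at-skip)))
      where
      H : ℕ → Bool
      H i = (i ≡ᵇ j) ∨ not ⌊ F (suc i) ℤ.≟ + suc i ⌋
      at-skip : ∀ i → ((skip j i ≡ᵇ j) ∨ not ⌊ F (suc (skip j i)) ℤ.≟ + suc (skip j i) ⌋) ≡ not ⌊ g (suc i) ℤ.≟ + suc i ⌋
      at-skip i rewrite ≡ᵇ-≢ (skip-≢ j i) | F-skip-suc i | suc-skip j i = cong not (⌊skipᶻ≟skipᶻ⌋ (suc j) (g (suc i)) (+ suc i))

    F-isSignedPerm : isSignedPermᶠ (suc t) F ≡ isSignedPermᶠ t g
    F-isSignedPerm = trans (AllFold.fold<-skip j t H j<1+t)
      (trans (cong (all (H ∘ skip j) (upTo t) ∧_) hit-j) (trans (𝔹.∧-identityʳ _) (all-cong (upTo t) hit-skip)))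
      where
      H : ℕ → Bool
      H v = any (λ i → ⌊ ∣ F (suc i) ∣ ℕ.≟ suc v ⌋) (upTo (suc t))
      hit-j : H j ≡ true
      hit-j = any<⁺ _ (suc t) j j<1+t (⌊⌋-true (_ ℕ.≟ _) (cong ∣_∣ F-j))
      hit-skip : ∀ v → H (skip j v) ≡ any (λ i → ⌊ ∣ g (suc i) ∣ ℕ.≟ suc v ⌋) (upTo t)
      hit-skip v = trans (AnyFold.fold<-skip j t Hv j<1+t)
        (trans (cong (any (Hv ∘ skip j) (upTo t) ∨_) miss-j) (trans (𝔹.∨-identityʳ _) (any-cong (upTo t) at-skip)))
        where
        Hv : ℕ → Bool
        Hv i = ⌊ ∣ F (suc i) ∣ ℕ.≟ suc (skip j v) ⌋
        miss-j : Hv j ≡ false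
        miss-j = ⌊⌋-false (_ ℕ.≟ _) (λ e → skip-≢ (suc j) (suc v) (trans (sym (suc-skip j v)) (sym (trans (sym (cong ∣_∣ F-j)) e))))
        at-skip : ∀ i → Hv (skip j i) ≡ ⌊ ∣ g (suc i) ∣ ℕ.≟ suc v ⌋
        at-skip i rewrite F-skip-suc i | ∣skipᶻ∣ (suc j) (g (suc i)) | suc-skip j v = ⌊⌋-cong-⇔ (_ ℕ.≟ _) (_ ℕ.≟ _) (skip-injective (suc j)) (cong (skip (suc j)))

    F-allInRange : InRangeᶠ t g → allInRangeᵇ (suc t) F ≡ true
    F-allInRange R = trans (AllFold.fold<-skip j t (λ i → inRangeᵇ (suc t) (F (suc i))) j<1+t) (∧-true (all<⁺ _ t at-skip) at-j)
      where
      at-j : inRangeᵇ (suc t) (F (suc j)) ≡ true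
      at-j rewrite F-j = ∧-true (⌊⌋-true (1 ℕ.≤? suc j) (s≤s z≤n)) (⌊⌋-true (suc j ℕ.≤? suc t) j<1+t)
      at-skip : ∀ i → i < t → inRangeᵇ (suc t) (F (suc (skip j i))) ≡ true
      at-skip i i<t rewrite F-skip-suc i | ∣skipᶻ∣ (suc j) (g (suc i)) =
        ∧-true (⌊⌋-true (1 ℕ.≤? _) (≤-trans (proj₁ (R i i<t)) (n≤skip (suc j) _))) (⌊⌋-true (_ ℕ.≤? suc t) (skip-≤ (suc j) (proj₂ (R i i<t))))

  filterᵇ-signedVals : ∀ j t → j ≤ t → filterᵇ (λ x → not (∣ x ∣ ≡ᵇ suc j)) (signedVals (suc t)) ≡ map (skipᶻ (suc j)) (signedVals t)
  filterᵇ-signedVals j t j≤t with j ≟ t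
  ... | yes refl = begin
    filterᵇ p (signedVals (suc j))                             ≡⟨ cong (filterᵇ p) (signedVals-suc j) ⟩
    filterᵇ p (signedVals j ++ _)                              ≡⟨ filter-++ (T? ∘ p) (signedVals j) _ ⟩
    filterᵇ p (signedVals j) ++ filterᵇ p ((+ suc j) ∷ (- (+ suc j)) ∷ [])
                                                               ≡⟨ cong (filterᵇ p (signedVals j) ++_) drop-top ⟩
    filterᵇ p (signedVals j) ++ []                             ≡⟨ ++-identityʳ _ ⟩
    filterᵇ p (signedVals j)                                   ≡⟨ filter-all (T? ∘ p) (All.map (λ {x} → keep {x}) (signedVals-InRange j)) ⟩
    signedVals j                                               ≡⟨ sym (map-id-local (All.map (λ {x} (_ , le) → skipᶻ-below (suc j) x (s≤s le)) (signedVals-InRange j))) ⟩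
    map (skipᶻ (suc j)) (signedVals j)                         ∎
    where
    open ≡-Reasoning
    p = λ (x : ℤ) → not (∣ x ∣ ≡ᵇ suc j)
    keep : ∀ {x} → InRange j x → T (p x)
    keep {x} (_ , le) rewrite ≡ᵇ-≢ {∣ x ∣} {suc j} (<⇒≢ (s≤s le)) = _
    drop-top : filterᵇ p ((+ suc j) ∷ (- (+ suc j)) ∷ []) ≡ []
    drop-top = filter-none (T? ∘ p) {(+ suc j) ∷ (- (+ suc j)) ∷ []} (drop ∷ drop ∷ [])
      where
      drop : ¬ T (not (j ≡ᵇ j))
      drop = subst (λ b → ¬ T (not b)) (sym (≡ᵇ-refl j)) (λ ())
  filterᵇ-signedVals j (suc t) j≤1+t | no j≢1+t = begin
    filterᵇ p (signedVals (suc (suc t)))                       ≡⟨ cong (filterᵇ p) (signedVals-suc (suc t)) ⟩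
    filterᵇ p (signedVals (suc t) ++ _)                        ≡⟨ filter-++ (T? ∘ p) (signedVals (suc t)) _ ⟩
    filterᵇ p (signedVals (suc t)) ++ filterᵇ p ((+ suc (suc t)) ∷ (- (+ suc (suc t))) ∷ [])
                                                               ≡⟨ cong₂ _++_ (filterᵇ-signedVals j t j≤t) keep-top ⟩
    map (skipᶻ (suc j)) (signedVals t) ++ ((+ suc (suc t)) ∷ (- (+ suc (suc t))) ∷ [])
                                                               ≡⟨ cong (map (skipᶻ (suc j)) (signedVals t) ++_) (sym shift-top) ⟩
    map (skipᶻ (suc j)) (signedVals t) ++ map (skipᶻ (suc j)) ((+ suc t) ∷ (- (+ suc t)) ∷ [])
                                                               ≡⟨ sym (map-++ (skipᶻ (suc j)) (signedVals t) _) ⟩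
    map (skipᶻ (suc j)) (signedVals t ++ _)                    ≡⟨ cong (map (skipᶻ (suc j))) (sym (signedVals-suc t)) ⟩
    map (skipᶻ (suc j)) (signedVals (suc t))                   ∎
    where
    open ≡-Reasoning
    p = λ (x : ℤ) → not (∣ x ∣ ≡ᵇ suc j)
    j≤t : j ≤ t
    j≤t = ≤-pred (≤∧≢⇒< j≤1+t j≢1+t)
    keep-top : filterᵇ p ((+ suc (suc t)) ∷ (- (+ suc (suc t))) ∷ []) ≡ (+ suc (suc t)) ∷ (- (+ suc (suc t))) ∷ []
    keep-top = filter-all (T? ∘ p) {(+ suc (suc t)) ∷ (- (+ suc (suc t))) ∷ []} (keep ∷ keep ∷ [])
      where
      keep : T (not (suc t ≡ᵇ j))
      keep = subst (T ∘ not) (sym (≡ᵇ-≢ {suc t} {j} (<⇒≢ (s≤s j≤t) ∘ sym))) _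
    shift-top : map (skipᶻ (suc j)) ((+ suc t) ∷ (- (+ suc t)) ∷ []) ≡ (+ suc (suc t)) ∷ (- (+ suc (suc t))) ∷ []
    shift-top rewrite skip-≥ {suc j} {suc t} (s≤s j≤t) = refl
  filterᵇ-signedVals zero    zero    _  | no j≢0 = ⊥-elim (j≢0 refl)
  filterᵇ-signedVals (suc j) zero    () | no _

  ∑-onlyFixedAt : ∀ t j k → j < suc t →
    ∑ (vecsOver (suc t) (signedVals (suc t))) (λ w → χ (allInRangeᵇ (suc t) (entry w) ∧ onlyFixedAt (suc t) j k (entry w))) ≡ d t k
  ∑-onlyFixedAt t j k j<1+t = begin
    ∑ (vecsOver (suc t) Xs) G                      ≡⟨ ∑-vecsOver-insertAt t j Xs G (≤-pred j<1+t) ⟩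
    ∑ Xs (λ x → ∑ (vecsOver t Xs) (λ u → G (insertAt u j x)))
                                                   ≡⟨ ∑-signedVals-single (suc t) (suc j) _ (s≤s z≤n) j<1+t not-fixed ⟩
    ∑ (vecsOver t Xs) H                            ≡⟨ ∑-vecsOver-filterᵇ isJ t Xs H value-j-twice ⟩
    ∑ (vecsOver t (filterᵇ (not ∘ isJ) Xs)) H      ≡⟨ cong (λ l → ∑ (vecsOver t l) H) (filterᵇ-signedVals j t (≤-pred j<1+t)) ⟩
    ∑ (vecsOver t (map (skipᶻ (suc j)) (signedVals t))) H
                                                   ≡⟨ ∑-vecsOver-map t (signedVals t) (skipᶻ (suc j)) H ⟩
    ∑ (vecsOver t (signedVals t)) (H ∘ Vec.map (skipᶻ (suc j)))
                                                   ≡⟨ ∑-congᴬ (All.map (λ a → relabelled (entry-All a)) (vecsOver-All t (signedVals t) (signedVals-InRange t))) ⟩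
    ∑ (vecsOver t (signedVals t)) (λ u → χ (inD t k (entry u)))
                                                   ≡⟨ sym (d≡∑vecsOver t k) ⟩
    d t k                                          ∎
    where
    open ≡-Reasoning
    module Ins = InsertedFixedPoint t j j<1+t
    Xs = signedVals (suc t)
    G : Vec ℤ (suc t) → ℕ
    G w = χ (allInRangeᵇ (suc t) (entry w) ∧ onlyFixedAt (suc t) j k (entry w))
    isJ = λ (x : ℤ) → ∣ x ∣ ≡ᵇ suc j
    H = λ (u : Vec ℤ t) → G (insertAt u j (+ suc j))
    not-fixed : ∀ x → x ≢ + suc j → ∑ (vecsOver t Xs) (λ u → G (insertAt u j x)) ≡ 0
    not-fixed x x≢ = ∑-zero (vecsOver t Xs) (λ u → cong χ (trans
      (cong (λ b → allInRangeᵇ (suc t) (v u) ∧ isSignedPermᶠ (suc t) (v u) ∧ b ∧ isDerangementExceptᶠ (suc t) j (v u) ∧ (excᶠ (suc t) (v u) ≡ᵇ k)) (unfixed u))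
      (∧-zero₃ (allInRangeᵇ (suc t) (v u)) (isSignedPermᶠ (suc t) (v u)) (isDerangementExceptᶠ (suc t) j (v u) ∧ (excᶠ (suc t) (v u) ≡ᵇ k)))))
      where
      v = λ (u : Vec ℤ t) → entry (insertAt u j x)
      unfixed : ∀ u → isFixedᶠ j (v u) ≡ false
      unfixed u = trans (cong (λ z → ⌊ z ℤ.≟ + suc j ⌋) (trans (entry-insertAt u j x (suc j) (≤-pred j<1+t))
          (cong₂ (λ a b → if a then entry u (suc j) else if b then x else entry u j) (<ᵇ-false {suc j} ≤-refl) (≡ᵇ-refl j))))
        (⌊⌋-false (x ℤ.≟ + suc j) x≢)
    value-j-twice : ∀ u → 1 ≤ countᵇ isJ u → H u ≡ 0
    value-j-twice u c with allInRangeᵇ (suc t) (entry (insertAt u j (+ suc j))) in inRange | isSignedPermᶠ (suc t) (entry (insertAt u j (+ suc j))) in isPerm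
    ... | false | _     = refl
    ... | true  | false = refl
    ... | true  | true  = ⊥-elim (<-irrefl refl (subst (2 ≤_) once twice))
      where
      v = insertAt u j (+ suc j)
      twice : 2 ≤ countᵇ isJ v
      twice = subst (2 ≤_) (sym (trans (countᵇ-insertAt isJ u j (+ suc j)) (cong (λ b → χ b + countᵇ isJ u) (≡ᵇ-refl j)))) (s≤s c)
      once : countᵇ isJ v ≡ 1
      once = trans (countᵇ-entry isJ v) (multiplicity≡1 (suc t) (entry v) (allInRangeᵇ-sound (suc t) (entry v) inRange) isPerm j j<1+t)
    relabelled : ∀ {u} → InRangeᶠ t (entry u) → H (Vec.map (skipᶻ (suc j)) u) ≡ χ (inD t k (entry u))
    relabelled {u} R rewrite Ins.F-allInRange u R | Ins.F-isSignedPerm u | Ins.F-fixed u | Ins.F-isDerangementExcept u | Ins.F-exc u = refl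

  module Recurrence (t k : ℕ) where
    private
      m = suc t
      n = suc m
      Xs = signedVals m
      ws = vecsOver m Xs

      tops : List ℤ
      tops = top m true ∷ top m false ∷ []

      isTop : ℤ → Bool
      isTop x = ∣ x ∣ ≡ᵇ suc m

      W : Vec ℤ n → ℕ
      W = 𝟙D n (suc k)

      ws-InRange : All (λ w → InRangeᶠ m (entry w)) ws
      ws-InRange = All.map entry-All (vecsOver-All m Xs (signedVals-InRange m))

      d-as-∑ : d n (suc k) ≡ ∑ (vecsOver n (Xs ++ tops)) W
      d-as-∑ = trans (d≡∑vecsOver n (suc k)) (trans
        (∑-congᴬ (All.map (λ {v} a → cong (λ b → χ (b ∧ inD n (suc k) (entry v))) (sym (allInRangeᵇ-complete n (entry v) (entry-All a))))
                          (vecsOver-All n (signedVals n) (signedVals-InRange n))))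
        (cong (λ l → ∑ (vecsOver n l) W) (signedVals-suc m)))

      Xs-not-top : All (λ x → isTop x ≡ false) Xs
      Xs-not-top = All.map (λ {x} (_ , le) → ≡ᵇ-≢ (<⇒≢ (s≤s le))) (signedVals-InRange m)

      W-top-twice : ∀ v → 2 ≤ countᵇ isTop v → W v ≡ 0
      W-top-twice v c with allInRangeᵇ n (entry v) in inRange | isSignedPermᶠ n (entry v) in isPerm
      ... | false | _     = refl
      ... | true  | false = refl
      ... | true  | true  = ⊥-elim (<-irrefl refl (subst (2 ≤_) once c))
        where
        once : countᵇ isTop v ≡ 1
        once = trans (countᵇ-entry isTop v) (multiplicity≡1 n (entry v) (allInRangeᵇ-sound n (entry v) inRange) isPerm m (n<1+n m))

      no-top : ∑ (vecsOver n Xs) W ≡ 0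
      no-top = ∑-zeroᴬ (All.map (λ {v} a → W-small {v} (entry-All a)) (vecsOver-All n Xs (signedVals-InRange m)))
        where
        W-small : ∀ {v} → (∀ i → i < n → InRange m (entry v (suc i))) → W v ≡ 0
        W-small {v} R with allInRangeᵇ n (entry v) | isSignedPermᶠ n (entry v) in isPerm
        ... | false | _     = refl
        ... | true  | false = refl
        ... | true  | true  with isSignedPerm-surjective n (entry v) isPerm m (n<1+n m)
        ... | i , i<n , e = ⊥-elim (<-irrefl e (s≤s (proj₂ (R i i<n))))

      top-last : ∑ tops (λ y → ∑ ws (λ w → W (w ∷ʳ y))) ≡ d m k
      top-last = trans (cong₂ (λ a b → a + (b + 0)) (∑-zero ws {λ w → W (w ∷ʳ top m true)} fixed-last) (∑-congᴬ (All.map (λ {w} → negative-last {w}) ws-InRange)))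
                       (trans (+-identityʳ _) (sym (d≡∑vecsOver m k)))
        where
        fixed : ∀ w → isFixedᶠ m (entry (w ∷ʳ top m true)) ≡ true
        fixed w = ⌊⌋-true (_ ℤ.≟ _) (trans (entry-∷ʳ w (top m true) (suc m)) (cong (λ b → if b then top m true else entry w (suc m)) (≡ᵇ-refl m)))
        fixed-last : ∀ w → W (w ∷ʳ top m true) ≡ 0
        fixed-last w rewrite isDerangement-fixed n m (entry (w ∷ʳ top m true)) (n<1+n m) (fixed w) =
          cong χ (∧-zero₃ (allInRangeᵇ n v) (isSignedPermᶠ n v) (isDerangementᶠ n v ∧ (excᶠ n v ≡ᵇ suc k)))
          where v = entry (w ∷ʳ top m true)
        negative-last : ∀ {w} → InRangeᶠ m (entry w) → W (w ∷ʳ top m false) ≡ χ (inD m k (entry w))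
        negative-last {w} R = cong χ (begin
          allInRangeᵇ n (entry v) ∧ inD n (suc k) (entry v)  ≡⟨ cong₂ _∧_ (allInRangeᵇ-cong entry≗g n) (inD-cong entry≗g n (suc k)) ⟩
          allInRangeᵇ n g ∧ inD n (suc k) g                  ≡⟨ cong (_∧ inD n (suc k) g) (allInRangeᵇ-complete n g g-InRange) ⟩
          inD n (suc k) g                                    ≡⟨ cong₂ _∧_ g-isSignedPerm (cong₂ _∧_ g-isDerangement (cong (_≡ᵇ suc k) g-exc)) ⟩
          inD m k (entry w)                                  ∎)
          where
          open ≡-Reasoning
          open AppendedNegative m (entry w) R
          v = w ∷ʳ top m false
          entry≗g : ∀ i → entry v i ≡ g i
          entry≗g = entry-∷ʳ w (top m false)

      Q : ℕ → Vec ℤ m → ℕ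
      Q k′ w = χ (inD m k′ (entry w))

      Y : Vec ℤ m → ℕ
      Y w = ∑< m (λ j → χ (onlyFixedAt m j k (entry w)))

      Tₛ : Bool → Vec ℤ m → ℕ
      Tₛ s w = ∑< m (λ j → W (displace w j (top m s)))

      per-w : ∀ {w} → InRangeᶠ m (entry w) → Tₛ true w + (Tₛ false w + 0) + 2 * (k * Q k w) ≡ 2 * (suc k * Q (suc k) w) + 2 * (m * Q k w) + 2 * Y w
      per-w {w} R = double (Tₛ true w) (Tₛ false w) (k * Q k w) (suc k * Q (suc k) w) (m * Q k w) (Y w)
        (DisplacedVec.∑-𝟙D-displace-count m w R k true) (DisplacedVec.∑-𝟙D-displace-count m w R k false)
        where
        double : ∀ x₁ x₂ q a b y → x₁ + q ≡ a + b + y → x₂ + q ≡ a + b + y → x₁ + (x₂ + 0) + 2 * q ≡ 2 * a + 2 * b + 2 * y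
        double x₁ x₂ q a b y e₁ e₂ = trans (split x₁ x₂ q) (trans (cong₂ _+_ e₁ e₂) (merge a b y))
          where
          split : ∀ x₁ x₂ q → x₁ + (x₂ + 0) + 2 * q ≡ (x₁ + q) + (x₂ + q)
          split = solve-∀
          merge : ∀ a b y → (a + b + y) + (a + b + y) ≡ 2 * a + 2 * b + 2 * y
          merge = solve-∀

      ∑-Y : ∑ ws Y ≡ m * d t k
      ∑-Y = trans (∑-swap ws (upTo m) (λ w j → χ (onlyFixedAt m j k (entry w))))
        (trans (∑<-cong m (λ j j<m → trans (∑-congᴬ (All.map (λ {w} → in-range {j} {w}) ws-InRange)) (∑-onlyFixedAt t j k j<m))) (∑<-const m (d t k)))
        where
        in-range : ∀ {j w} → InRangeᶠ m (entry w) → χ (onlyFixedAt m j k (entry w)) ≡ χ (allInRangeᵇ m (entry w) ∧ onlyFixedAt m j k (entry w))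
        in-range {j} {w} R = cong (λ b → χ (b ∧ onlyFixedAt m j k (entry w))) (sym (allInRangeᵇ-complete m (entry w) R))

      top-displaced : ∑< m (λ j → ∑ tops (λ y → ∑ ws (λ w → W (displace w j y)))) + 2 * (k * d m k)
                      ≡ 2 * (suc k * d m (suc k)) + 2 * (m * d m k) + 2 * (m * d t k)
      top-displaced = begin
        ∑< m (λ j → ∑ tops (λ y → ∑ ws (λ w → W (displace w j y)))) + 2 * (k * d m k)
          ≡⟨ cong₂ (λ a b → a + 2 * (k * b)) swap (d≡∑vecsOver m k) ⟩
        ∑ ws Tw + 2 * (k * ∑ ws (Q k))
          ≡⟨ trans (cong (_+_ (∑ ws Tw)) (sym (∑-2* ws k (Q k)))) (sym (∑-+ ws Tw (λ w → 2 * (k * Q k w)))) ⟩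
        ∑ ws (λ w → Tw w + 2 * (k * Q k w))
          ≡⟨ ∑-congᴬ (All.map (λ {w} → per-w {w}) ws-InRange) ⟩
        ∑ ws (λ w → 2 * (suc k * Q (suc k) w) + 2 * (m * Q k w) + 2 * Y w)
          ≡⟨ trans (∑-+ ws _ _) (cong₂ _+_ (∑-+ ws _ _) (∑-*ˡ ws 2 Y)) ⟩
        ∑ ws (λ w → 2 * (suc k * Q (suc k) w)) + ∑ ws (λ w → 2 * (m * Q k w)) + 2 * ∑ ws Y
          ≡⟨ cong₂ _+_ (cong₂ _+_ (∑-2* ws (suc k) (Q (suc k))) (∑-2* ws m (Q k))) (cong (2 *_) ∑-Y) ⟩
        2 * (suc k * ∑ ws (Q (suc k))) + 2 * (m * ∑ ws (Q k)) + 2 * (m * d t k)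
          ≡⟨ cong₂ (λ a b → 2 * (suc k * a) + 2 * (m * b) + 2 * (m * d t k)) (sym (d≡∑vecsOver m (suc k))) (sym (d≡∑vecsOver m k)) ⟩
        2 * (suc k * d m (suc k)) + 2 * (m * d m k) + 2 * (m * d t k)
          ∎
        where
        open ≡-Reasoning
        Tw : Vec ℤ m → ℕ
        Tw w = ∑ tops (λ y → ∑< m (λ j → W (displace w j y)))
        ∑-2* : ∀ xs c (h : Vec ℤ m → ℕ) → ∑ xs (λ x → 2 * (c * h x)) ≡ 2 * (c * ∑ xs h)
        ∑-2* xs c h = trans (∑-*ˡ xs 2 _) (cong (2 *_) (∑-*ˡ xs c h))
        swap : ∑< m (λ j → ∑ tops (λ y → ∑ ws (λ w → W (displace w j y)))) ≡ ∑ ws Tw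
        swap = trans (∑-cong (upTo m) (λ j → ∑-swap tops ws (λ y w → W (displace w j y))))
          (trans (∑-swap (upTo m) ws (λ j w → ∑ tops (λ y → W (displace w j y))))
            (∑-cong ws (λ w → ∑-swap (upTo m) tops (λ j y → W (displace w j y)))))

    recurrenceℕ : d n (suc k) + 2 * (k * d m k) ≡ d m k + (2 * (suc k * d m (suc k)) + 2 * (m * d m k) + 2 * (m * d t k))
    recurrenceℕ = begin
      d n (suc k) + 2 * (k * d m k)
        ≡⟨ cong (_+ 2 * (k * d m k)) (trans d-as-∑ (∑-vecsOver-split isTop m Xs tops Xs-not-top (≡ᵇ-refl m ∷ ≡ᵇ-refl m ∷ []) W W-top-twice)) ⟩
      ∑ (vecsOver n Xs) W + ∑ tops (λ y → ∑ ws (λ w → W (w ∷ʳ y))) + ∑< m (λ j → ∑ tops (λ y → ∑ ws (λ w → W (displace w j y)))) + 2 * (k * d m k)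
        ≡⟨ cong (λ a → a + ∑< m (λ j → ∑ tops (λ y → ∑ ws (λ w → W (displace w j y)))) + 2 * (k * d m k)) (cong₂ _+_ no-top top-last) ⟩
      d m k + ∑< m (λ j → ∑ tops (λ y → ∑ ws (λ w → W (displace w j y)))) + 2 * (k * d m k)
        ≡⟨ +-assoc (d m k) _ _ ⟩
      d m k + (∑< m (λ j → ∑ tops (λ y → ∑ ws (λ w → W (displace w j y)))) + 2 * (k * d m k))
        ≡⟨ cong (_+_ (d m k)) top-displaced ⟩
      d m k + (2 * (suc k * d m (suc k)) + 2 * (m * d m k) + 2 * (m * d t k))
        ∎
      where open ≡-Reasoning

  pos-2* : ∀ x y → + (2 * (x * y)) ≡ + 2 ℤ.* (+ x ℤ.* + y)
  pos-2* x y = trans (ℤ.pos-* 2 (x * y)) (cong (ℤ._*_ (+ 2)) (ℤ.pos-* x y))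

  recurrenceℤ : ∀ {D A B C} k t → D + 2 * (k * A) ≡ A + (2 * (suc k * B) + 2 * (suc t * A) + 2 * (suc t * C)) →
    + D ≡ + (2 * suc k) ℤ.* + B ℤ.+ (+ (2 * suc (suc t)) ℤ.- + (2 * suc k) ℤ.+ + 1) ℤ.* + A ℤ.+ + (2 * suc t) ℤ.* + C
  recurrenceℤ {D} {A} {B} {C} k t eq = begin
    + D
      ≡⟨ unshift (+ D) (+ 2 ℤ.* (+ k ℤ.* + A)) ⟩
    + D ℤ.+ + 2 ℤ.* (+ k ℤ.* + A) ℤ.- + 2 ℤ.* (+ k ℤ.* + A)
      ≡⟨ cong (ℤ._- + 2 ℤ.* (+ k ℤ.* + A)) lifted ⟩
    + A ℤ.+ (+ 2 ℤ.* ((+ 1 ℤ.+ + k) ℤ.* + B) ℤ.+ + 2 ℤ.* ((+ 1 ℤ.+ + t) ℤ.* + A) ℤ.+ + 2 ℤ.* ((+ 1 ℤ.+ + t) ℤ.* + C)) ℤ.- + 2 ℤ.* (+ k ℤ.* + A)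
      ≡⟨ regroup (+ A) (+ B) (+ C) (+ k) (+ t) ⟩
    + 2 ℤ.* (+ 1 ℤ.+ + k) ℤ.* + B ℤ.+ (+ 2 ℤ.* (+ 1 ℤ.+ (+ 1 ℤ.+ + t)) ℤ.- + 2 ℤ.* (+ 1 ℤ.+ + k) ℤ.+ + 1) ℤ.* + A ℤ.+ + 2 ℤ.* (+ 1 ℤ.+ + t) ℤ.* + C
      ∎
    where
    open ≡-Reasoning
    unshift : ∀ d x → d ≡ d ℤ.+ x ℤ.- x
    unshift = ℤ-Solver.solve-∀
    regroup : ∀ A B C k t →
      A ℤ.+ (+ 2 ℤ.* ((+ 1 ℤ.+ k) ℤ.* B) ℤ.+ + 2 ℤ.* ((+ 1 ℤ.+ t) ℤ.* A) ℤ.+ + 2 ℤ.* ((+ 1 ℤ.+ t) ℤ.* C)) ℤ.- + 2 ℤ.* (k ℤ.* A)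
      ≡ + 2 ℤ.* (+ 1 ℤ.+ k) ℤ.* B ℤ.+ (+ 2 ℤ.* (+ 1 ℤ.+ (+ 1 ℤ.+ t)) ℤ.- + 2 ℤ.* (+ 1 ℤ.+ k) ℤ.+ + 1) ℤ.* A ℤ.+ + 2 ℤ.* (+ 1 ℤ.+ t) ℤ.* C
    regroup = ℤ-Solver.solve-∀
    lifted : + D ℤ.+ + 2 ℤ.* (+ k ℤ.* + A)
           ≡ + A ℤ.+ (+ 2 ℤ.* ((+ 1 ℤ.+ + k) ℤ.* + B) ℤ.+ + 2 ℤ.* ((+ 1 ℤ.+ + t) ℤ.* + A) ℤ.+ + 2 ℤ.* ((+ 1 ℤ.+ + t) ℤ.* + C))
    lifted = begin
      + D ℤ.+ + 2 ℤ.* (+ k ℤ.* + A)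
        ≡⟨ cong (ℤ._+_ (+ D)) (sym (pos-2* k A)) ⟩
      + (D + 2 * (k * A))
        ≡⟨ cong +_ eq ⟩
      + A ℤ.+ (+ (2 * (suc k * B)) ℤ.+ + (2 * (suc t * A)) ℤ.+ + (2 * (suc t * C)))
        ≡⟨ cong (ℤ._+_ (+ A)) (cong₂ ℤ._+_ (cong₂ ℤ._+_ (pos-2* (suc k) B) (pos-2* (suc t) A)) (pos-2* (suc t) C)) ⟩
      + A ℤ.+ (+ 2 ℤ.* ((+ 1 ℤ.+ + k) ℤ.* + B) ℤ.+ + 2 ℤ.* ((+ 1 ℤ.+ + t) ℤ.* + A) ℤ.+ + 2 ℤ.* ((+ 1 ℤ.+ + t) ℤ.* + C))
        ∎

open import Data.Integer using (ℤ; +_; _+_; _-_; _*_)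
open import Data.Nat using (ℕ; zero; suc; _≤_; _∸_; s≤s)
open import Relation.Binary.PropositionalEquality using (_≡_)
open import Defs
open TypeBDerangements using (module Recurrence; recurrenceℤ)

corollary4p3 : (n k : ℕ) → 2 ≤ n → 1 ≤ k →
    + d n k ≡ (+ (2 Data.Nat.* k)) * (+ d (n ∸ 1) k)
    + ((+ (2 Data.Nat.* n)) - (+ (2 Data.Nat.* k)) + (+ 1)) * (+ d (n ∸ 1) (k ∸ 1))
    + (+ (2 Data.Nat.* (n ∸ 1))) * (+ d (n ∸ 2) (k ∸ 1))
corollary4p3 (suc (suc t)) (suc k) _ _ = recurrenceℤ {B = d (suc t) (suc k)} {C = d t k} k t (Recurrence.recurrenceℕ t k)
corollary4p3 (suc zero) _ (s≤s ()) _
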